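{- Let $1\le m\le n$ and $0\le k<n$. The number of $k$-Naples $(m,n)$-parking functions is \[ |\mathrm{PF}_{m,n}(k)|=\sum_{\pi=\pi_1\cdots\pi_n\in\mathfrak{S}_{m,n}}\left(\prod_{i=1}^n\bigl[\widetilde{\mathrm{B}}(\pi_i)+\widetilde{\mathrm{F}}(\pi_i)+1\bigr]\right), \] where $\widetilde{\mathrm{B}}(0)=\widetilde{\mathrm{F}}(0)=0$ and, for $\pi_i>0$, $\widetilde{\mathrm{B}}(\pi_i)=\min(\mathrm{Right}(\pi_i),k)$ and $\widetilde{\mathrm{F}}(\pi_i)$ equals $0$ if $\mathrm{Left}(\pi_i)=0$, $\min(i-1,n-1)$ if $0<\mathrm{Left}(\pi_i)=i-1$, and $\max(\min(\mathrm{Left}(\pi_i)-k,n-1),0)$ if $0<\mathrm{Left}(\pi_i)<i-1$ (i.e., the functions $\mathrm{B},\mathrm{F}$ of the $(k,\ell)$-pullback count specialized to $\ell=n-1$).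
   Context: $k$-Naples parking rule on a one-way street with spots $1,\dots,n$, cars $1,\dots,m$ with preferences $\alpha=(a_1,\dots,a_m)\in[n]^m$ entering in order: car $j$ parks in spot $a_j$ if empty; otherwise it checks spots $a_j-1,\dots,a_j-k$ in order (stopping at the start of the street) and parks in the first empty one; if none, it proceeds forward from $a_j$ and parks in the first empty spot after $a_j$ (if any, up to spot $n$); otherwise it fails. $\mathrm{PF}_{m,n}(k)$ is the set of $\alpha$ under which all cars park; it coincides with the set of $(k,n-1)$-pullback $(m,n)$-parking functions (pullback rule: after failing to back up, a car checks only spots $a_j+1,\dots,a_j+\ell$). $\mathfrak{S}_{m,n}$ is the set of words $\pi_1\cdots\pi_n$ that are permutations of the multiset of $n-m$ zeros and the elements of $[m]$. $\mathrm{Right}(\pi_i)$ is the largest $x\ge0$ with $0<\pi_t<\pi_i$ for all $i+1\le t\le i+x\le n$; $\mathrm{Left}(\pi_i)$ is the largest $x\ge0$ with $0<\pi_t<\pi_i$ for all $1\le i-x\le t\le i-1$. -}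

module Defs where

open import Data.Nat using (ℕ; zero; suc; _+_; _*_; _∸_; _≤_; _<_; _<ᵇ_; _≡ᵇ_)
open import Data.Nat.Base using (_⊓_)
open import Data.Bool using (Bool; true; false; if_then_else_; _∧_; not)
open import Data.List using (List; []; _∷_; _++_; map; length; concatMap; reverse; filterᵇ)
open import Data.Nat.ListAction using (sum)
open import Data.Maybe using (Maybe; just; nothing)

-- Spots and cars are numbered from 1. A street state is the list of occupied spots.

fromTo : ℕ → ℕ → List ℕ
fromTo a b = go a (suc b ∸ a)
  where
  go : ℕ → ℕ → List ℕ
  go x zero    = []
  go x (suc c) = x ∷ go (suc x) c

occupied : List ℕ → ℕ → Bool
occupied []       s = false
occupied (x ∷ xs) s = if x ≡ᵇ s then true else occupied xs s

firstFree : List ℕ → List ℕ → Maybe ℕ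
firstFree occ []       = nothing
firstFree occ (s ∷ ss) = if occupied occ s then firstFree occ ss else just s

-- Spots a car with preference a inspects under the k-Naples rule on a street
-- with n spots, in order: a, then a-1, …, a-k (not going below spot 1),
-- then a+1, …, n.
naplesCandidates : ℕ → ℕ → ℕ → List ℕ
naplesCandidates k n a =
  a ∷ (map (λ i → a ∸ i) (fromTo 1 (k ⊓ (a ∸ 1))) ++ fromTo (suc a) n)

parkAll : ℕ → ℕ → List ℕ → List ℕ → Bool
parkAll k n occ []       = true
parkAll k n occ (a ∷ as) with firstFree occ (naplesCandidates k n a)
... | nothing = false
... | just s  = parkAll k n (s ∷ occ) as

words : ℕ → List ℕ → List (List ℕ)
words zero    xs = [] ∷ []
words (suc m) xs = concatMap (λ x → map (x ∷_) (words m xs)) xs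

isNaplesPF : ℕ → ℕ → List ℕ → Bool
isNaplesPF k n α = parkAll k n [] α

numNaplesPF : ℕ → ℕ → ℕ → ℕ
numNaplesPF m n k = length (filterᵇ (isNaplesPF k n) (words m (fromTo 1 n)))

occurrences : ℕ → List ℕ → ℕ
occurrences x []       = 0
occurrences x (y ∷ ys) = (if x ≡ᵇ y then 1 else 0) + occurrences x ys

allTrue : List Bool → Bool
allTrue []       = true
allTrue (b ∷ bs) = b ∧ allTrue bs

-- 𝔖_{m,n}: words of length n over {0,…,m} in which each of 1,…,m occurs
-- exactly once (hence 0 occurs n-m times): the permutations of the
-- multiset {0^{n-m}} ∪ [m].
isInS : ℕ → List ℕ → Bool
isInS m w = allTrue (map (λ j → occurrences j w ≡ᵇ 1) (fromTo 1 m))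

S : ℕ → ℕ → List (List ℕ)
S m n = filterᵇ (isInS m) (words n (fromTo 0 m))

run : ℕ → List ℕ → ℕ
run v []       = 0
run v (t ∷ ts) = if (0 <ᵇ t) ∧ (t <ᵇ v) then suc (run v ts) else 0

-- Right(π_i) = run π_i (π_{i+1} … π_n);
-- Left(π_i)  = run π_i (π_{i-1} … π_1)  (prefix read backwards).

-- B̃(π_i) + F̃(π_i) + 1, where i is the (1-based) position, `pre` the
-- prefix π_1…π_{i-1} reversed, `suf` the suffix π_{i+1}…π_n.
factor : ℕ → ℕ → ℕ → List ℕ → ℕ → List ℕ → ℕ
factor k n i pre zero    suf = 1
factor k n i pre (suc v) suf = Btil + Ftil + 1
  where
  R L Btil Ftil : ℕ
  R = run (suc v) suf
  L = run (suc v) pre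
  Btil = R ⊓ k
  -- max(min(L-k, n-1), 0) equals (L ∸ k) ⊓ (n ∸ 1) over ℕ
  Ftil = if L ≡ᵇ 0 then 0
         else if L ≡ᵇ (i ∸ 1) then (i ∸ 1) ⊓ (n ∸ 1)
         else (L ∸ k) ⊓ (n ∸ 1)

prodFactors : ℕ → ℕ → List ℕ → ℕ → List ℕ → ℕ
prodFactors k n pre i []       = 1
prodFactors k n pre i (v ∷ vs) = factor k n i pre v vs * prodFactors k n (v ∷ pre) (suc i) vs

weight : ℕ → ℕ → List ℕ → ℕ
weight k n π = prodFactors k n [] 1 π

rhs : ℕ → ℕ → ℕ → ℕ
rhs m n k = sum (map (weight k n) (S m n))

-- Sort the preference sequences by their outcome p, car v parking at spot p_v. Car v,
-- arriving at the street occupied by p_1, …, p_(v-1), parks at p_v for a certain number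
-- of preferences, so the number of sequences with outcome p is the product of these
-- counts; it vanishes unless the spots are distinct. Outcomes with distinct spots
-- correspond to the words π ∈ 𝔖_{m,n} (π_i is the car parked at spot i, 0 if none), and
-- the street met by car π_i consists of the spots holding smaller labels. Its free spot i
-- is reached from i itself, from the B̃(π_i) spots to its right from which backing up
-- crosses the occupied block of length Right(π_i), and from the F̃(π_i) spots to its left
-- whose whole back-up window lies in the occupied block of length Left(π_i), from where
-- the car drives forward. So car π_i contributes B̃ + F̃ + 1, and the product over the
-- cars is the product over the spots of π.

module Submission where

open import Defs
open import Algebra.Bundles using (CommutativeSemigroup)
open import Algebra.Core using (Op₂)
open import Algebra.Structures using (IsCommutativeMonoid)
open import Data.Bool using (Bool; true; false; if_then_else_)
open import Data.Empty using (⊥; ⊥-elim)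
open import Data.List using (List; []; _∷_; _++_; _ʳ++_; map; concatMap; length; filterᵇ)
open import Data.List.Properties as List using ()
open import Data.List.Relation.Unary.All as All using (All; []; _∷_)
import Data.List.Relation.Unary.All.Properties as AllP
open import Data.Maybe using (Maybe; just; nothing; maybe′; _<∣>_)
open import Data.Maybe.Properties as Maybe using ()
open import Data.Maybe.Relation.Unary.All as Maybe using (just; nothing)
open import Data.Nat
  using (ℕ; zero; suc; _+_; _*_; _∸_; _⊓_; _⊔_; _≤_; _<_; z≤n; s≤s; z<s; _≟_; _≤?_; _<?_; _≡ᵇ_)
open import Data.Nat.ListAction using (sum)
open import Data.Nat.Properties
open import Data.Nat.Solver using (module +-*-Solver)
open import Data.Product using (_×_; _,_; ∃-syntax; proj₁; proj₂)
open import Data.Sum using (_⊎_; inj₁; inj₂)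
open import Function using (_∘_; id)
open import Level using (0ℓ)
open import Relation.Binary.Definitions using (DecidableEquality)
open import Relation.Binary.PropositionalEquality
open import Relation.Nullary using (¬_; Dec; contradiction; does; proof; yes; no; Reflects; ofʸ; ofⁿ)
open import Relation.Nullary.Decidable using (dec-true; dec-false; _×-dec_)
open import Relation.Unary using (Decidable)

open +-*-Solver using (solve; _:+_; _:=_; con)
open ≡-Reasoning

≡ᵇ-reflects : ∀ m n → Reflects (m ≡ n) (m ≡ᵇ n)
≡ᵇ-reflects m n = proof (m ≟ n)

does-true : ∀ {P : Set} (d : Dec P) → does d ≡ true → P
does-true (yes p) _ = p

Bool-ext : ∀ {b b′ : Bool} → (b ≡ true → b′ ≡ true) → (b′ ≡ true → b ≡ true) → b ≡ b′
Bool-ext {true}  {b′}    ⇒ _ = sym (⇒ refl)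
Bool-ext {false} {true}  _ ⇐ = ⇐ refl
Bool-ext {false} {false} _ _ = refl

if-yes : ∀ {P : Set} {B : Set} (d : Dec P) {x y : B} → P → (if does d then x else y) ≡ x
if-yes d p = cong (λ b → if b then _ else _) (dec-true d p)

if-no : ∀ {P : Set} {B : Set} (d : Dec P) {x y : B} → ¬ P → (if does d then x else y) ≡ y
if-no d ¬p = cong (λ b → if b then _ else _) (dec-false d ¬p)

maybe′-cong : ∀ {B C : Set} {f g : B → C} {z : C} → (∀ x → f x ≡ g x) →
              ∀ m → maybe′ f z m ≡ maybe′ g z m
maybe′-cong f≗g (just x) = f≗g x
maybe′-cong f≗g nothing  = refl

<∣>-just : ∀ {m m′ : Maybe ℕ} {s} → (m <∣> m′) ≡ just s →
           m ≡ just s ⊎ (m ≡ nothing × m′ ≡ just s)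
<∣>-just {just _}  eq = inj₁ eq
<∣>-just {nothing} eq = inj₂ (refl , eq)

-- Ranges and words

range : ℕ → ℕ → List ℕ
range x zero    = []
range x (suc c) = x ∷ range (suc x) c

InRange : ℕ → ℕ → ℕ → Set
InRange x c a = x ≤ a × a < x + c

All-InRange-range : ∀ x c → All (InRange x c) (range x c)
All-InRange-range x zero    = []
All-InRange-range x (suc c) =
  (≤-refl , subst (x <_) (sym (+-suc x c)) (s≤s (m≤m+n x c))) ∷
  All.map (λ {a} (x<a , a<x+c) → <⇒≤ x<a , subst (a <_) (sym (+-suc x c)) a<x+c)
          (All-InRange-range (suc x) c)

All-range⁻ : ∀ {P : ℕ → Set} x c → All P (range x c) → ∀ {a} → InRange x c a → P a
All-range⁻ x zero    []         (x≤a , a<x+0) =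
  contradiction (<-≤-trans a<x+0 (subst (_≤ _) (sym (+-identityʳ x)) x≤a)) (<-irrefl refl)
All-range⁻ x (suc c) (Px ∷ Ps) {a} (x≤a , a<x+1+c) with x ≟ a
... | yes refl = Px
... | no  x≢a  = All-range⁻ (suc x) c Ps (≤∧≢⇒< x≤a x≢a , subst (a <_) (+-suc x c) a<x+1+c)

range-++ : ∀ x c d → range x (c + d) ≡ range x c ++ range (x + c) d
range-++ x zero    d = cong (λ y → range y d) (sym (+-identityʳ x))
range-++ x (suc c) d = cong (x ∷_) (trans (range-++ (suc x) c d)
  (cong (λ y → range (suc x) c ++ range y d) (sym (+-suc x c))))

length-range : ∀ x c → length (range x c) ≡ c
length-range x zero    = refl
length-range x (suc c) = cong suc (length-range (suc x) c)

fromTo≡range : ∀ a b → fromTo a b ≡ range a (suc b ∸ a)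
fromTo≡range a b = go (suc b ∸ a) a refl
  where
  go : ∀ c a → suc b ∸ a ≡ c → fromTo a b ≡ range a c
  go zero    a eq rewrite eq = refl
  go (suc c) a eq with a ≤? b
  ... | yes a≤b rewrite +-∸-assoc 1 a≤b = cong (a ∷_) (go c (suc a) (suc-injective eq))
  ... | no  a≰b = contradiction (trans (sym eq) (m≤n⇒m∸n≡0 (≰⇒> a≰b))) λ ()

Word : ℕ → ℕ → ℕ → List ℕ → Set
Word r lo c w = length w ≡ r × All (InRange lo c) w

All-words : ∀ {P : ℕ → Set} r {xs} → All P xs → All (λ w → length w ≡ r × All P w) (words r xs)
All-words zero    all-xs = (refl , []) ∷ []
All-words (suc r) {xs} all-xs = AllP.concat⁺ (AllP.map⁺ (All.map
  (λ Px → AllP.map⁺ (All.map (λ (len , all) → cong suc len , Px ∷ all) (All-words r all-xs)))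
  all-xs))

-- Big operators over lists

module BigOperator {A : Set} {_∙_ : Op₂ A} {ε : A}
                   (isCommutativeMonoid : IsCommutativeMonoid _≡_ _∙_ ε) where

  open IsCommutativeMonoid isCommutativeMonoid using (assoc; identityˡ; identityʳ; isCommutativeSemigroup)

  commutativeSemigroup : CommutativeSemigroup 0ℓ 0ℓ
  commutativeSemigroup = record { isCommutativeSemigroup = isCommutativeSemigroup }

  open import Algebra.Properties.CommutativeSemigroup commutativeSemigroup using (interchange)

  big : {B : Set} → List B → (B → A) → A
  big []       f = ε
  big (x ∷ xs) f = f x ∙ big xs f

  private variable B C : Set

  big-cong : (xs : List B) {f g : B → A} → (∀ x → f x ≡ g x) → big xs f ≡ big xs g
  big-cong []       f≗g = refl
  big-cong (x ∷ xs) f≗g = cong₂ _∙_ (f≗g x) (big-cong xs f≗g)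

  big-congᴬ : {xs : List B} {f g : B → A} → All (λ x → f x ≡ g x) xs → big xs f ≡ big xs g
  big-congᴬ []           = refl
  big-congᴬ (fx≡gx ∷ eqs) = cong₂ _∙_ fx≡gx (big-congᴬ eqs)

  big-ε : (xs : List B) → big xs (λ _ → ε) ≡ ε
  big-ε []       = refl
  big-ε (x ∷ xs) = trans (cong (ε ∙_) (big-ε xs)) (identityˡ ε)

  big-++ : (xs ys : List B) (f : B → A) → big (xs ++ ys) f ≡ big xs f ∙ big ys f
  big-++ []       ys f = sym (identityˡ _)
  big-++ (x ∷ xs) ys f = trans (cong (f x ∙_) (big-++ xs ys f)) (sym (assoc _ _ _))

  big-∙ : (xs : List B) (f g : B → A) → big xs (λ x → f x ∙ g x) ≡ big xs f ∙ big xs g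
  big-∙ []       f g = sym (identityˡ ε)
  big-∙ (x ∷ xs) f g =
    trans (cong ((f x ∙ g x) ∙_) (big-∙ xs f g)) (interchange (f x) (g x) (big xs f) (big xs g))

  big-comm : (xs : List B) (ys : List C) (f : B → C → A) →
             big xs (λ x → big ys (f x)) ≡ big ys (λ y → big xs (λ x → f x y))
  big-comm []       ys f = sym (big-ε ys)
  big-comm (x ∷ xs) ys f =
    trans (cong (big ys (f x) ∙_) (big-comm xs ys f)) (sym (big-∙ ys (f x) _))

  big-map : (g : C → B) (xs : List C) (f : B → A) →
            big (map g xs) f ≡ big xs (λ x → f (g x))
  big-map g []       f = refl
  big-map g (x ∷ xs) f = cong (f (g x) ∙_) (big-map g xs f)

  big-concatMap : (g : C → List B) (xs : List C) (f : B → A) →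
                  big (concatMap g xs) f ≡ big xs (λ x → big (g x) f)
  big-concatMap g []       f = refl
  big-concatMap g (x ∷ xs) f =
    trans (big-++ (g x) _ f) (cong (big (g x) f ∙_) (big-concatMap g xs f))

  big-words-suc : ∀ r (xs : List ℕ) (f : List ℕ → A) →
                  big (words (suc r) xs) f ≡ big xs (λ x → big (words r xs) (λ w → f (x ∷ w)))
  big-words-suc r xs f = begin
    big (concatMap (λ x → map (x ∷_) (words r xs)) xs) f
      ≡⟨ big-concatMap _ xs f ⟩
    big xs (λ x → big (map (x ∷_) (words r xs)) f)
      ≡⟨ big-cong xs (λ x → big-map (x ∷_) (words r xs) f) ⟩
    big xs (λ x → big (words r xs) (λ w → f (x ∷ w))) ∎

  Selects : {X : Set} → DecidableEquality X → List X → (X → Set) → Set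
  Selects {X} _≟X_ xs P =
    ∀ {x} → P x → (f : X → A) → big xs (λ x′ → if does (x ≟X x′) then f x′ else ε) ≡ f x

  big-select-below : ∀ {s} x c (f : ℕ → A) → s < x →
                     big (range x c) (λ a → if s ≡ᵇ a then f a else ε) ≡ ε
  big-select-below x zero    f s<x = refl
  big-select-below {s} x (suc c) f s<x with s ≡ᵇ x | ≡ᵇ-reflects s x
  ... | true  | ofʸ refl = ⊥-elim (<-irrefl refl s<x)
  ... | false | ofⁿ _    = trans (identityˡ _) (big-select-below (suc x) c f (m<n⇒m<1+n s<x))

  big-select : ∀ x c → Selects _≟_ (range x c) (InRange x c)
  big-select x zero    {s} (x≤s , s<x+0) f =
    ⊥-elim (<-irrefl refl (<-≤-trans s<x+0 (subst (_≤ s) (sym (+-identityʳ x)) x≤s)))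
  big-select x (suc c) {s} (x≤s , s<x+1+c) f with s ≡ᵇ x | ≡ᵇ-reflects s x
  ... | true  | ofʸ refl = trans (cong (f s ∙_) (big-select-below (suc x) c f ≤-refl)) (identityʳ (f s))
  ... | false | ofⁿ s≢x  = trans (identityˡ _)
        (big-select (suc x) c (≤∧≢⇒< x≤s (s≢x ∘ sym) , subst (s <_) (+-suc x c) s<x+1+c) f)

  big-select-or-ε : ∀ c (f : ℕ → A) → f 0 ≡ ε → ∀ {x} → x < 1 + c →
                    f x ≡ big (range 1 c) (λ v → if x ≡ᵇ v then f v else ε)
  big-select-or-ε c f f0≡ε {zero}  _   = trans f0≡ε (sym (big-select-below 1 c f (s≤s z≤n)))
  big-select-or-ε c f f0≡ε {suc x} x<c = sym (big-select 1 c (s≤s z≤n , x<c) f)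

  big-select-maybe : ∀ x c {m : Maybe ℕ} → Maybe.All (InRange x c) m → (f : ℕ → A) →
    maybe′ f ε m ≡ big (range x c) (λ p → if does (Maybe.≡-dec _≟_ m (just p)) then f p else ε)
  big-select-maybe x c (just s∈) f = sym (big-select x c s∈ f)
  big-select-maybe x c nothing   f = sym (big-ε (range x c))

  big-select-word : ∀ r lo c → Selects (List.≡-dec _≟_) (words r (range lo c)) (Word r lo c)
  big-select-word zero    lo c {[]}     (refl , [])          f = identityʳ (f [])
  big-select-word (suc r) lo c {y ∷ ys} (refl , y∈ ∷ ys∈) f = begin
    big (words (suc r) L) f′
      ≡⟨ big-words-suc r L f′ ⟩
    big L (λ x → big W (λ w → f′ (x ∷ w)))
      ≡⟨ big-cong L split ⟩
    big L (λ x → if y ≡ᵇ x then big W (λ w → if does (ys ≟ₗ w) then f (x ∷ w) else ε) else ε)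
      ≡⟨ big-select lo c y∈ _ ⟩
    big W (λ w → if does (ys ≟ₗ w) then f (y ∷ w) else ε)
      ≡⟨ big-select-word r lo c (refl , ys∈) (λ w → f (y ∷ w)) ⟩
    f (y ∷ ys) ∎
    where
    _≟ₗ_ : DecidableEquality (List ℕ)
    _≟ₗ_ = List.≡-dec _≟_
    L : List ℕ
    L = range lo c
    W : List (List ℕ)
    W = words r L
    f′ : List ℕ → A
    f′ w = if does ((y ∷ ys) ≟ₗ w) then f w else ε
    split : ∀ x → big W (λ w → f′ (x ∷ w))
                ≡ (if y ≡ᵇ x then big W (λ w → if does (ys ≟ₗ w) then f (x ∷ w) else ε) else ε)
    split x with y ≡ᵇ x
    ... | true  = refl
    ... | false = big-ε W

  module _ {X Y : Set} (_≟X_ : DecidableEquality X) (_≟Y_ : DecidableEquality Y)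
           {P : X → Set} {Q : Y → Set} {xs : List X} {ys : List Y}
           (all-xs : All P xs) (all-ys : All Q ys)
           (select-xs : Selects _≟X_ xs P) (select-ys : Selects _≟Y_ ys Q)
           (F : X → A) (G : Y → A) (g : X → Y) (h : Y → X)
           (F-matched : ∀ x → P x → F x ≡ ε ⊎ (Q (g x) × h (g x) ≡ x × G (g x) ≡ F x))
           (G-matched : ∀ y → Q y → G y ≡ ε ⊎ (P (h y) × g (h y) ≡ y × F (h y) ≡ G y)) where

    private
      if-ε : ∀ (b : Bool) → (if b then ε else ε) ≡ ε
      if-ε true  = refl
      if-ε false = refl

      spread-F : ∀ x → P x → F x ≡ big ys (λ y → if does (g x ≟Y y) then F x else ε)
      spread-F x Px with F-matched x Px
      ... | inj₁ Fx≡ε rewrite Fx≡ε =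
        sym (trans (big-cong ys (λ y → if-ε (does (g x ≟Y y)))) (big-ε ys))
      ... | inj₂ (Qgx , _ , _) = sym (select-ys Qgx (λ _ → F x))

      collect-G : ∀ y → Q y → big xs (λ x → if does (h y ≟X x) then G y else ε) ≡ G y
      collect-G y Qy with G-matched y Qy
      ... | inj₁ Gy≡ε rewrite Gy≡ε = trans (big-cong xs (λ x → if-ε (does (h y ≟X x)))) (big-ε xs)
      ... | inj₂ (Phy , _ , _) = select-xs Phy (λ _ → G y)

      matched-pair : ∀ x y → P x → Q y → g x ≡ y → h y ≡ x → F x ≡ G y
      matched-pair x y Px Qy gx≡y hy≡x with F-matched x Px | G-matched y Qy
      ... | inj₂ (_ , _ , Ggx≡Fx) | _                     = trans (sym Ggx≡Fx) (cong G gx≡y)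
      ... | inj₁ Fx≡ε            | inj₁ Gy≡ε             = trans Fx≡ε (sym Gy≡ε)
      ... | inj₁ _               | inj₂ (_ , _ , Fhy≡Gy) = trans (cong F (sym hy≡x)) Fhy≡Gy

      delta-symmetric : ∀ x y → P x → Q y →
        (if does (g x ≟Y y) then F x else ε) ≡ (if does (h y ≟X x) then G y else ε)
      delta-symmetric x y Px Qy with g x ≟Y y | h y ≟X x
      ... | yes gx≡y | yes hy≡x = matched-pair x y Px Qy gx≡y hy≡x
      ... | no  _    | no  _    = refl
      ... | yes gx≡y | no  hy≢x with F-matched x Px
      ...   | inj₁ Fx≡ε           = Fx≡ε
      ...   | inj₂ (_ , hgx≡x , _) = contradiction (trans (cong h (sym gx≡y)) hgx≡x) hy≢x
      delta-symmetric x y Px Qy | no gx≢y | yes hy≡x with G-matched y Qy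
      ...   | inj₁ Gy≡ε           = sym Gy≡ε
      ...   | inj₂ (_ , ghy≡y , _) = contradiction (trans (cong g (sym hy≡x)) ghy≡y) gx≢y

    big-reindex : big xs F ≡ big ys G
    big-reindex = begin
      big xs F
        ≡⟨ big-congᴬ (All.map (λ {x} Px → spread-F x Px) all-xs) ⟩
      big xs (λ x → big ys (λ y → if does (g x ≟Y y) then F x else ε))
        ≡⟨ big-congᴬ (All.map (λ Px → big-congᴬ (All.map (delta-symmetric _ _ Px) all-ys)) all-xs) ⟩
      big xs (λ x → big ys (λ y → if does (h y ≟X x) then G y else ε))
        ≡⟨ big-comm xs ys _ ⟩
      big ys (λ y → big xs (λ x → if does (h y ≟X x) then G y else ε))
        ≡⟨ big-congᴬ (All.map (λ {y} Qy → collect-G y Qy) all-ys) ⟩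
      big ys G ∎

module Sum     = BigOperator +-0-isCommutativeMonoid
module Product = BigOperator *-1-isCommutativeMonoid

iverson : Bool → ℕ
iverson b = if b then 1 else 0

iverson-* : ∀ b x → (if b then x else 0) ≡ iverson b * x
iverson-* true  x = sym (+-identityʳ x)
iverson-* false x = refl

module _ {B : Set} where

  length-filterᵇ : (p : B → Bool) (xs : List B) → length (filterᵇ p xs) ≡ Sum.big xs (iverson ∘ p)
  length-filterᵇ p []       = refl
  length-filterᵇ p (x ∷ xs) with p x
  ... | true  = cong suc (length-filterᵇ p xs)
  ... | false = length-filterᵇ p xs

  sum-map-filterᵇ : (p : B → Bool) (f : B → ℕ) (xs : List B) →
                    sum (map f (filterᵇ p xs)) ≡ Sum.big xs (λ x → if p x then f x else 0)
  sum-map-filterᵇ p f []       = refl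
  sum-map-filterᵇ p f (x ∷ xs) with p x
  ... | true  = cong (f x +_) (sum-map-filterᵇ p f xs)
  ... | false = sum-map-filterᵇ p f xs

  sum-*ˡ : ∀ c (xs : List B) (f : B → ℕ) → c * Sum.big xs f ≡ Sum.big xs (λ x → c * f x)
  sum-*ˡ c []       f = *-zeroʳ c
  sum-*ˡ c (x ∷ xs) f = trans (*-distribˡ-+ c (f x) _) (cong (c * f x +_) (sum-*ˡ c xs f))

  sum-*ʳ : ∀ c (xs : List B) (f : B → ℕ) → Sum.big xs f * c ≡ Sum.big xs (λ x → f x * c)
  sum-*ʳ c []       f = refl
  sum-*ʳ c (x ∷ xs) f = trans (*-distribʳ-+ c (f x) _) (cong (f x * c +_) (sum-*ʳ c xs f))

sum-ones : ∀ x c → Sum.big (range x c) (λ _ → 1) ≡ c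
sum-ones x zero    = refl
sum-ones x (suc c) = cong suc (sum-ones (suc x) c)

-- Lists indexed from 1

-- Off the list (and at index 0) the junk value 0 is returned, which is also the label of an empty spot.
entry : List ℕ → ℕ → ℕ
entry []       _             = 0
entry (x ∷ xs) zero          = 0
entry (x ∷ xs) (suc zero)    = x
entry (x ∷ xs) (suc (suc i)) = entry xs (suc i)

Index : List ℕ → ℕ → Set
Index xs = InRange 1 (length xs)

InRange⇒Index : ∀ xs {r i} → length xs ≡ r → InRange 1 r i → Index xs i
InRange⇒Index xs {i = i} len = subst (λ r → InRange 1 r i) (sym len)

Index⇒InRange : ∀ xs {r i} → length xs ≡ r → Index xs i → InRange 1 r i
Index⇒InRange xs {i = i} len = subst (λ r → InRange 1 r i) len

All-entry : ∀ {P : ℕ → Set} {xs i} → All P xs → Index xs i → P (entry xs i)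
All-entry {i = suc _}       []         (_ , s≤s ())
All-entry {i = suc zero}    (Px ∷ _)   _               = Px
All-entry {i = suc (suc i)} (_  ∷ Pxs) (_ , s≤s i<len) = All-entry Pxs (s≤s z≤n , i<len)

entry-All : ∀ {P : ℕ → Set} xs → (∀ {i} → Index xs i → P (entry xs i)) → All P xs
entry-All       []       P-entry = []
entry-All {P} (x ∷ xs) P-entry = P-entry (≤-refl , s≤s (s≤s z≤n)) ∷ entry-All xs P-entry′
  where
  P-entry′ : ∀ {i} → Index xs i → P (entry xs i)
  P-entry′ {suc i} (_ , i<len) = P-entry (s≤s z≤n , s≤s i<len)

entry-ext : ∀ xs ys → length xs ≡ length ys → (∀ {i} → Index xs i → entry xs i ≡ entry ys i) →
            xs ≡ ys
entry-ext []       []       _   _         = refl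
entry-ext (x ∷ xs) (y ∷ ys) len same-entry = cong₂ _∷_ (same-entry (≤-refl , s≤s (s≤s z≤n)))
  (entry-ext xs ys (suc-injective len) same-entry′)
  where
  same-entry′ : ∀ {i} → Index xs i → entry xs i ≡ entry ys i
  same-entry′ {suc i} (_ , i<len) = same-entry (s≤s z≤n , s≤s i<len)

entry-map-range : ∀ (f : ℕ → ℕ) x c {i} → i < c → entry (map f (range x c)) (suc i) ≡ f (x + i)
entry-map-range f x (suc c) {zero}  _         = cong f (sym (+-identityʳ x))
entry-map-range f x (suc c) {suc i} (s≤s i<c) = trans (entry-map-range f (suc x) c i<c) (cong f (sym (+-suc x i)))

entry-map-range₁ : ∀ (f : ℕ → ℕ) c {i} → InRange 1 c i → entry (map f (range 1 c)) i ≡ f i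
entry-map-range₁ f c {suc i} (_ , s≤s i<c) = entry-map-range f 1 c i<c

entry-ʳ++-right : ∀ pre ys i → entry (pre ʳ++ ys) (length pre + suc i) ≡ entry ys (suc i)
entry-ʳ++-right []        ys i = refl
entry-ʳ++-right (x ∷ pre) ys i =
  trans (cong (entry (pre ʳ++ x ∷ ys)) (sym (+-suc (length pre) (suc i))))
        (entry-ʳ++-right pre (x ∷ ys) (suc i))

entry-ʳ++-left : ∀ pre ys {d} → d < length pre → entry (pre ʳ++ ys) (length pre ∸ d) ≡ entry pre (suc d)
entry-ʳ++-left (x ∷ pre) ys {zero}  _ =
  trans (cong (entry (pre ʳ++ x ∷ ys)) (+-comm 1 (length pre))) (entry-ʳ++-right pre (x ∷ ys) 0)
entry-ʳ++-left (x ∷ pre) ys {suc d} (s≤s d<len) = entry-ʳ++-left pre (x ∷ ys) d<len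

DistinctEntries : List ℕ → Set
DistinctEntries xs = ∀ {i i′} → Index xs i → Index xs i′ → entry xs i ≡ entry xs i′ → i ≡ i′

occupied⇒entry : ∀ xs {s} → occupied xs s ≡ true → ∃[ i ] Index xs i × entry xs i ≡ s
occupied⇒entry (x ∷ xs) {s} occ with x ≡ᵇ s | ≡ᵇ-reflects x s
... | true  | ofʸ x≡s = 1 , (≤-refl , s≤s (s≤s z≤n)) , x≡s
... | false | _ with occupied⇒entry xs occ
...   | suc i , (_ , i<len) , entry≡s = suc (suc i) , (s≤s z≤n , s≤s i<len) , entry≡s

entry⇒occupied : ∀ xs {i s} → Index xs i → entry xs i ≡ s → occupied xs s ≡ true
entry⇒occupied []       {suc _} (_ , s≤s ()) _
entry⇒occupied (x ∷ xs) {i} {s} i∈ entry≡s with x ≡ᵇ s | ≡ᵇ-reflects x s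
... | true  | _        = refl
... | false | ofⁿ x≢s with i | i∈
...   | suc zero    | _              = contradiction entry≡s x≢s
...   | suc (suc i) | (_ , s≤s i<len) = entry⇒occupied xs (s≤s z≤n , i<len) entry≡s

-- 1-based position of the first occurrence; 0 if there is none.
positionOf : ℕ → List ℕ → ℕ
positionOf v []       = 0
positionOf v (x ∷ xs) with v ≡ᵇ x | positionOf v xs
... | true  | _     = 1
... | false | zero  = 0
... | false | suc i = suc (suc i)

positionOf≤length : ∀ v xs → positionOf v xs ≤ length xs
positionOf≤length v []       = z≤n
positionOf≤length v (x ∷ xs) with v ≡ᵇ x | positionOf v xs | positionOf≤length v xs
... | true  | _     | _       = s≤s z≤n
... | false | zero  | _       = z≤n
... | false | suc i | i<len   = s≤s i<len

entry-positionOf : ∀ v xs → 1 ≤ positionOf v xs → entry xs (positionOf v xs) ≡ v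
entry-positionOf v (x ∷ xs) found with v ≡ᵇ x | ≡ᵇ-reflects v x | positionOf v xs | entry-positionOf v xs
... | true  | ofʸ v≡x | _     | _  = sym v≡x
... | false | _       | suc i | ih = ih (s≤s z≤n)

entry⇒positionOf-found : ∀ v xs {i} → Index xs i → entry xs i ≡ v → 1 ≤ positionOf v xs
entry⇒positionOf-found v []       {suc _} (_ , s≤s ()) _
entry⇒positionOf-found v (x ∷ xs) {i} i∈ entry≡v
  with v ≡ᵇ x | ≡ᵇ-reflects v x | positionOf v xs | entry⇒positionOf-found v xs
... | true  | _       | _     | _  = s≤s z≤n
... | false | _       | suc _ | _  = s≤s z≤n
... | false | ofⁿ v≢x | zero  | ih with i | i∈
...   | suc zero    | _               = contradiction (sym entry≡v) v≢x
...   | suc (suc i) | (_ , s≤s i<len) with () ← ih (s≤s z≤n , i<len) entry≡v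

OccursOnlyAt : ℕ → List ℕ → ℕ → Set
OccursOnlyAt v xs i =
  Index xs i × entry xs i ≡ v × (∀ {i′} → Index xs i′ → entry xs i′ ≡ v → i′ ≡ i)

OccursOnlyAt-positionOf : ∀ {v} xs {i} → OccursOnlyAt v xs i → positionOf v xs ≡ i
OccursOnlyAt-positionOf {v} xs (i∈ , entry≡v , only) =
  only (found , s≤s (positionOf≤length v xs)) (entry-positionOf v xs found)
  where
  found : 1 ≤ positionOf v xs
  found = entry⇒positionOf-found v xs i∈ entry≡v

occurrences≡0⇒absent : ∀ v xs {i} → occurrences v xs ≡ 0 → Index xs i → entry xs i ≢ v
occurrences≡0⇒absent v []       {suc _} _    (_ , s≤s ())
occurrences≡0⇒absent v (x ∷ xs) {suc i} none i∈ entry≡v with v ≡ᵇ x | ≡ᵇ-reflects v x | i | i∈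
... | false | ofⁿ v≢x | zero   | _               = v≢x (sym entry≡v)
... | false | _       | suc i′ | (_ , s≤s i<len) =
  occurrences≡0⇒absent v xs none (s≤s z≤n , i<len) entry≡v

absent⇒occurrences≡0 : ∀ v xs → (∀ {i} → Index xs i → entry xs i ≢ v) → occurrences v xs ≡ 0
absent⇒occurrences≡0 v []       _      = refl
absent⇒occurrences≡0 v (x ∷ xs) absent with v ≡ᵇ x | ≡ᵇ-reflects v x
... | true  | ofʸ v≡x = contradiction (sym v≡x) (absent (≤-refl , s≤s (s≤s z≤n)))
... | false | _       = absent⇒occurrences≡0 v xs absent′
  where
  absent′ : ∀ {i} → Index xs i → entry xs i ≢ v
  absent′ {suc i} (_ , i<len) = absent (s≤s z≤n , s≤s i<len)

occurrences≡1⇒OccursOnlyAt : ∀ v xs → occurrences v xs ≡ 1 → OccursOnlyAt v xs (positionOf v xs)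
occurrences≡1⇒OccursOnlyAt v (x ∷ xs) once
  with v ≡ᵇ x | ≡ᵇ-reflects v x | positionOf v xs | occurrences≡1⇒OccursOnlyAt v xs
... | true  | ofʸ refl | _ | _ = (≤-refl , s≤s (s≤s z≤n)) , refl , only
  where
  only : ∀ {i′} → Index (x ∷ xs) i′ → entry (x ∷ xs) i′ ≡ x → i′ ≡ 1
  only {suc zero}     _               _        = refl
  only {suc (suc i′)} (_ , s≤s i<len) entry≡x =
    contradiction entry≡x (occurrences≡0⇒absent x xs (suc-injective once) (s≤s z≤n , i<len))
... | false | _       | zero  | ih with () ← proj₁ (proj₁ (ih once))
... | false | ofⁿ v≢x | suc i | ih with ih once
...   | (_ , s≤s i<len) , entry≡v , only = (s≤s z≤n , s≤s (s≤s i<len)) , entry≡v , only′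
  where
  only′ : ∀ {i′} → Index (x ∷ xs) i′ → entry (x ∷ xs) i′ ≡ v → i′ ≡ suc (suc i)
  only′ {suc zero}     _                e = contradiction (sym e) v≢x
  only′ {suc (suc i′)} (_ , s≤s i′<len) e = cong suc (only (s≤s z≤n , i′<len) e)

OccursOnlyAt⇒occurrences≡1 : ∀ v xs {i} → OccursOnlyAt v xs i → occurrences v xs ≡ 1
OccursOnlyAt⇒occurrences≡1 v (x ∷ xs) {suc i} ((_ , s≤s i<len) , entry≡v , only)
  with v ≡ᵇ x | ≡ᵇ-reflects v x | i
... | true  | _       | zero   = cong suc (absent⇒occurrences≡0 v xs absent)
  where
  absent : ∀ {i′} → Index xs i′ → entry xs i′ ≢ v
  absent {suc i′} (_ , i′<len) entry≡v′ =
    contradiction (only (s≤s z≤n , s≤s i′<len) entry≡v′) λ ()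
... | true  | ofʸ v≡x | suc i′ = contradiction (only (≤-refl , s≤s (s≤s z≤n)) (sym v≡x)) λ ()
... | false | ofⁿ v≢x | zero   = contradiction (sym entry≡v) v≢x
... | false | _       | suc i′ = OccursOnlyAt⇒occurrences≡1 v xs ((s≤s z≤n , i<len) , entry≡v , only′)
  where
  only′ : ∀ {i″} → Index xs i″ → entry xs i″ ≡ v → i″ ≡ suc i′
  only′ {suc i″} (_ , i″<len) e = suc-injective (only (s≤s z≤n , s≤s i″<len) e)

module _ {P : ℕ → Set} (P? : Decidable P) where

  allTrue⇒All : ∀ xs → allTrue (map (does ∘ P?) xs) ≡ true → All P xs
  allTrue⇒All []       _   = []
  allTrue⇒All (x ∷ xs) all with P? x
  ... | yes Px = Px ∷ allTrue⇒All xs all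

  All⇒allTrue : ∀ {xs} → All P xs → allTrue (map (does ∘ P?) xs) ≡ true
  All⇒allTrue []                  = refl
  All⇒allTrue {x ∷ _} (Px ∷ Pxs) rewrite dec-true (P? x) Px = All⇒allTrue Pxs

isInS⇒OccursOnce : ∀ m w → isInS m w ≡ true → ∀ {v} → InRange 1 m v → occurrences v w ≡ 1
isInS⇒OccursOnce m w inS =
  All-range⁻ 1 m (subst (All _) (fromTo≡range 1 m)
                         (allTrue⇒All (λ v → occurrences v w ≟ 1) (fromTo 1 m) inS))

OccursOnce⇒isInS : ∀ m w → (∀ {v} → InRange 1 m v → occurrences v w ≡ 1) → isInS m w ≡ true
OccursOnce⇒isInS m w once rewrite fromTo≡range 1 m =
  All⇒allTrue (λ v → occurrences v w ≟ 1) (All.map once (All-InRange-range 1 m))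

-- Scanning for an unoccupied spot

firstUnoccupied : (ℕ → Bool) → List ℕ → Maybe ℕ
firstUnoccupied o []       = nothing
firstUnoccupied o (s ∷ ss) = if o s then firstUnoccupied o ss else just s

firstFree≡firstUnoccupied : ∀ occ ss → firstFree occ ss ≡ firstUnoccupied (occupied occ) ss
firstFree≡firstUnoccupied occ []       = refl
firstFree≡firstUnoccupied occ (s ∷ ss) with occupied occ s
... | true  = firstFree≡firstUnoccupied occ ss
... | false = refl

firstUnoccupied-cong : ∀ {o o′ ss} → All (λ s → o s ≡ o′ s) ss →
                       firstUnoccupied o ss ≡ firstUnoccupied o′ ss
firstUnoccupied-cong {ss = []}     []               = refl
firstUnoccupied-cong {o′ = o′} {ss = s ∷ ss} (os≡o′s ∷ eqs) rewrite os≡o′s with o′ s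
... | true  = firstUnoccupied-cong eqs
... | false = refl

firstUnoccupied-++ : ∀ o xs ys →
  firstUnoccupied o (xs ++ ys) ≡ (firstUnoccupied o xs <∣> firstUnoccupied o ys)
firstUnoccupied-++ o []       ys = refl
firstUnoccupied-++ o (x ∷ xs) ys with o x
... | true  = firstUnoccupied-++ o xs ys
... | false = refl

firstUnoccupied-All : ∀ {P : ℕ → Set} o {xs} → All P xs → Maybe.All P (firstUnoccupied o xs)
firstUnoccupied-All o []                 = nothing
firstUnoccupied-All o {x ∷ xs} (Px ∷ Pxs) with o x
... | true  = firstUnoccupied-All o Pxs
... | false = just Px

firstUnoccupied-unoccupied : ∀ o xs {s} → firstUnoccupied o xs ≡ just s → o s ≡ false
firstUnoccupied-unoccupied o (x ∷ xs) found with o x in ox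
... | true  = firstUnoccupied-unoccupied o xs found
... | false with refl ← found = ox

OccupiedOn : (ℕ → Bool) → (ℕ → ℕ) → ℕ → ℕ → Set
OccupiedOn o f x y = ∀ z → x ≤ z → z < y → o (f z) ≡ true

module _ (o : ℕ → Bool) (f : ℕ → ℕ) where

  private
    OccupiedOn-suc : ∀ {x y} → o (f x) ≡ true → OccupiedOn o f (suc x) y → OccupiedOn o f x y
    OccupiedOn-suc {x} ofx occ z x≤z z<y with x ≟ z
    ... | yes refl = ofx
    ... | no  x≢z  = occ z (≤∧≢⇒< x≤z x≢z) z<y

    +-suc-< : ∀ {z} x c → z < suc x + c → z < x + suc c
    +-suc-< {z} x c = subst (z <_) (sym (+-suc x c))

  scan-passes : ∀ x c → OccupiedOn o f x (x + c) → firstUnoccupied o (map f (range x c)) ≡ nothing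
  scan-passes x zero    occ = refl
  scan-passes x (suc c) occ rewrite occ x ≤-refl (m<m+n x z<s) =
    scan-passes (suc x) c (λ z x<z z<x+1+c → occ z (<⇒≤ x<z) (+-suc-< x c z<x+1+c))

  scan-stops : ∀ x c {y} → x ≤ y → y < x + c → OccupiedOn o f x y → o (f y) ≡ false →
               firstUnoccupied o (map f (range x c)) ≡ just (f y)
  scan-stops x zero    {y} x≤y y<x+0 occ ofy =
    contradiction (<-≤-trans y<x+0 (subst (_≤ y) (sym (+-identityʳ x)) x≤y)) (<-irrefl refl)
  scan-stops x (suc c) {y} x≤y y<x+1+c occ ofy with x ≟ y
  ... | yes refl rewrite ofy = refl
  ... | no  x≢y  rewrite occ x ≤-refl (≤∧≢⇒< x≤y x≢y) =
        scan-stops (suc x) c (≤∧≢⇒< x≤y x≢y) (subst (y <_) (+-suc x c) y<x+1+c)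
                   (λ z x<z → occ z (<⇒≤ x<z)) ofy

  scan-nothing : ∀ x c → firstUnoccupied o (map f (range x c)) ≡ nothing → OccupiedOn o f x (x + c)
  scan-nothing x zero    none z x≤z z<x+0 =
    contradiction (<-≤-trans z<x+0 (subst (_≤ z) (sym (+-identityʳ x)) x≤z)) (<-irrefl refl)
  scan-nothing x (suc c) none with o (f x) in ofx
  ... | true  = OccupiedOn-suc ofx (λ z x<z z<x+c+1 →
                  scan-nothing (suc x) c none z x<z (subst (z <_) (+-suc x c) z<x+c+1))

  scan-just : ∀ x c {s} → firstUnoccupied o (map f (range x c)) ≡ just s →
              ∃[ y ] x ≤ y × y < x + c × f y ≡ s × OccupiedOn o f x y
  scan-just x (suc c) found with o (f x) in ofx
  ... | false with refl ← found =
    x , ≤-refl , m<m+n x z<s , refl , λ z x≤z z<x → contradiction (≤-<-trans x≤z z<x) (<-irrefl refl)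
  scan-just x (suc c) found | true with scan-just (suc x) c found
  ...   | y , x<y , y<x+1+c , fy≡s , occ =
          y , <⇒≤ x<y , +-suc-< x c y<x+1+c , fy≡s , OccupiedOn-suc ofx occ

-- The k-Naples rule

backupDistance : ℕ → ℕ → ℕ
backupDistance k a = k ⊓ (a ∸ 1)

windowStart : ℕ → ℕ → ℕ
windowStart k a = a ∸ backupDistance k a

windowStart≡ : ∀ k a → 1 ≤ a → windowStart k a ≡ (a ∸ k) ⊔ 1
windowStart≡ k a 1≤a = trans (∸-distribˡ-⊓-⊔ a k (a ∸ 1)) (cong ((a ∸ k) ⊔_) (m∸[m∸n]≡n 1≤a))

1≤windowStart : ∀ k {a} → 1 ≤ a → 1 ≤ windowStart k a
1≤windowStart k {a} 1≤a = subst (1 ≤_) (sym (windowStart≡ k a 1≤a)) (m≤n⊔m (a ∸ k) 1)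

naplesCandidates-split : ∀ k n a → naplesCandidates k n a ≡
  map (a ∸_) (range 0 (suc (backupDistance k a))) ++ range (suc a) (n ∸ a)
naplesCandidates-split k n a
  rewrite fromTo≡range 1 (backupDistance k a) | fromTo≡range (suc a) n = refl

All-naplesCandidates : ∀ k n {a} → InRange 1 n a → All (InRange 1 n) (naplesCandidates k n a)
All-naplesCandidates k n {a} (1≤a , a≤n) rewrite naplesCandidates-split k n a =
  AllP.++⁺ (AllP.map⁺ (All.map backward (All-InRange-range 0 (suc (backupDistance k a)))))
           (All.map forward (All-InRange-range (suc a) (n ∸ a)))
  where
  backward : ∀ {i} → InRange 0 (suc (backupDistance k a)) i → InRange 1 n (a ∸ i)
  backward {i} (_ , i<1+C) =
    m<n⇒0<n∸m (<-≤-trans (s≤s (≤-trans (≤-pred i<1+C) (m⊓n≤n k (a ∸ 1))))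
                         (≤-reflexive (m+[n∸m]≡n 1≤a)))
    , ≤-<-trans (m∸n≤m a i) a≤n
  forward : ∀ {x} → InRange (suc a) (n ∸ a) x → InRange 1 n x
  forward (a<x , x<) = ≤-trans (s≤s z≤n) a<x
                     , <-≤-trans x< (s≤s (≤-reflexive (m+[n∸m]≡n (≤-pred a≤n))))

module _ (k j L : ℕ) (L<j : L < j) where

  private
    j∸[L∸k]∸k≡j∸L : k ≤ L → (j ∸ (L ∸ k)) ∸ k ≡ j ∸ L
    j∸[L∸k]∸k≡j∸L k≤L = trans (∸-+-assoc j (L ∸ k) k) (cong (j ∸_) (m∸n+n≡m k≤L))

  window-inside-block : ∀ a → a ≤ j → j ∸ (L ∸ k) < a → j ∸ L < windowStart k a
  window-inside-block a a≤j j∸F<a with k ≤? L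
  ... | no  k≰L =
    contradiction (subst (_< a) (cong (j ∸_) (m≤n⇒m∸n≡0 (≰⇒≥ k≰L))) j∸F<a) (≤⇒≯ a≤j)
  ... | yes k≤L =
    subst₂ _<_ (j∸[L∸k]∸k≡j∸L k≤L) (sym (windowStart≡ k a (≤-trans (s≤s z≤n) j∸F<a)))
               (<-≤-trans (∸-monoˡ-< j∸F<a k≤j∸F) (m≤m⊔n (a ∸ k) 1))
    where
    k≤j∸F : k ≤ j ∸ (L ∸ k)
    k≤j∸F = subst (_≤ j ∸ (L ∸ k)) (m∸[m∸n]≡n k≤L) (∸-monoˡ-≤ (L ∸ k) (<⇒≤ L<j))

  window-reaches-gap : ∀ a → 1 ≤ a → a ≤ j ∸ (L ∸ k) → windowStart k a ≤ j ∸ L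
  window-reaches-gap a 1≤a a≤j∸F = subst (_≤ j ∸ L) (sym (windowStart≡ k a 1≤a))
    (⊔-lub a∸k≤j∸L (m<n⇒0<n∸m L<j))
    where
    a∸k≤j∸L : a ∸ k ≤ j ∸ L
    a∸k≤j∸L with k ≤? L
    ... | yes k≤L = subst (a ∸ k ≤_) (j∸[L∸k]∸k≡j∸L k≤L) (∸-monoˡ-≤ k a≤j∸F)
    ... | no  k≰L = ≤-trans (∸-monoʳ-≤ a L≤k) (∸-monoˡ-≤ L (subst (a ≤_) (cong (j ∸_) (m≤n⇒m∸n≡0 L≤k)) a≤j∸F))
      where
      L≤k : L ≤ k
      L≤k = <⇒≤ (≰⇒> k≰L)

module Naples (k n : ℕ) where

  landing : (ℕ → Bool) → ℕ → Maybe ℕ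
  landing o a = firstUnoccupied o (naplesCandidates k n a)

  landing-InRange : ∀ o {a} → InRange 1 n a → Maybe.All (InRange 1 n) (landing o a)
  landing-InRange o a∈ = firstUnoccupied-All o (All-naplesCandidates k n a∈)

  landsAt : (ℕ → Bool) → ℕ → ℕ → Bool
  landsAt o s a = does (Maybe.≡-dec _≟_ (landing o a) (just s))

  landingCount : (ℕ → Bool) → ℕ → ℕ
  landingCount o s = Sum.big (range 1 n) (iverson ∘ landsAt o s)

  landingCount-cong : ∀ {o o′} → (∀ {s} → InRange 1 n s → o s ≡ o′ s) →
                      ∀ t → landingCount o t ≡ landingCount o′ t
  landingCount-cong o≗o′ t = Sum.big-congᴬ (All.map
    (λ a∈ → cong (λ r → iverson (does (Maybe.≡-dec _≟_ r (just t))))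
                 (firstUnoccupied-cong (All.map o≗o′ (All-naplesCandidates k n a∈))))
    (All-InRange-range 1 n))

  landingCount-occupied : ∀ o {s} → o s ≡ true → landingCount o s ≡ 0
  landingCount-occupied o {s} taken = trans
    (Sum.big-cong (range 1 n) λ a → cong iverson (dec-false (Maybe.≡-dec _≟_ (landing o a) (just s))
      λ lands → contradiction (trans (sym taken)
                                     (firstUnoccupied-unoccupied o (naplesCandidates k n a) lands)) λ ()))
    (Sum.big-ε (range 1 n))

  backwardScan forwardScan : (ℕ → Bool) → ℕ → Maybe ℕ
  backwardScan o a = firstUnoccupied o (map (a ∸_) (range 0 (suc (backupDistance k a))))
  forwardScan  o a = firstUnoccupied o (map id (range (suc a) (n ∸ a)))

  landing-split : ∀ o a → landing o a ≡ (backwardScan o a <∣> forwardScan o a)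
  landing-split o a rewrite List.map-id (range (suc a) (n ∸ a)) =
    trans (cong (firstUnoccupied o) (naplesCandidates-split k n a))
          (firstUnoccupied-++ o (map (a ∸_) (range 0 (suc (backupDistance k a)))) _)

  lands-by-backing-up : ∀ o j a → suc j ≤ a → a ≤ suc j + k → o (suc j) ≡ false →
    (∀ t → suc j < t → t ≤ a → o t ≡ true) → landing o a ≡ just (suc j)
  lands-by-backing-up o j a j<a a≤j+k free occ = begin
    landing o a                            ≡⟨ landing-split o a ⟩
    (backwardScan o a <∣> forwardScan o a) ≡⟨ cong (_<∣> forwardScan o a) stops ⟩
    just (a ∸ e)                           ≡⟨ cong just a∸e≡j+1 ⟩
    just (suc j)                           ∎
    where
    e : ℕ
    e = a ∸ suc j
    a∸e≡j+1 : a ∸ e ≡ suc j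
    a∸e≡j+1 = m∸[m∸n]≡n j<a
    e≤C : e ≤ backupDistance k a
    e≤C = ⊓-glb (m≤n+o⇒m∸n≤o a (suc j) a≤j+k) (∸-monoʳ-≤ a (s≤s z≤n))
    behind : OccupiedOn o (a ∸_) 0 e
    behind z _ z<e =
      occ (a ∸ z) (subst (_< a ∸ z) a∸e≡j+1 (∸-monoʳ-< z<e (m∸n≤m a (suc j)))) (m∸n≤m a z)
    stops : backwardScan o a ≡ just (a ∸ e)
    stops = scan-stops o (a ∸_) 0 _ z≤n (s≤s e≤C) behind
                       (subst (λ t → o t ≡ false) (sym a∸e≡j+1) free)

  misses-from-right : ∀ o j a → suc j < a →
    (suc j + k < a ⊎ ∃[ t ] suc j < t × t ≤ a × o t ≡ false) → landing o a ≢ just (suc j)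
  misses-from-right o j a j<a blocked lands rewrite landing-split o a with <∣>-just lands
  ... | inj₁ back with scan-just o (a ∸_) 0 (suc (backupDistance k a)) back
  ...   | y , _ , y≤C , a∸y≡j+1 , behind = blocked⇒⊥ blocked
    where
    y≡e : y ≡ a ∸ suc j
    y≡e = trans (sym (m∸[m∸n]≡n y≤a)) (cong (a ∸_) a∸y≡j+1)
      where
      y≤a : y ≤ a
      y≤a = ≤-trans (≤-pred y≤C) (≤-trans (m⊓n≤n k (a ∸ 1)) (m∸n≤m a 1))
    blocked⇒⊥ : (suc j + k < a ⊎ ∃[ t ] suc j < t × t ≤ a × o t ≡ false) → ⊥
    blocked⇒⊥ (inj₁ j+k<a) =
      <⇒≱ (subst (k <_) (sym y≡e) (m+n≤o⇒m≤o∸n (suc k) (subst (_≤ a) (cong suc (+-comm (suc j) k)) j+k<a)))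
          (≤-trans (≤-pred y≤C) (m⊓n≤m k (a ∸ 1)))
    blocked⇒⊥ (inj₂ (t , j<t , t≤a , free)) =
      contradiction (trans (sym (subst (λ u → o u ≡ true) (m∸[m∸n]≡n t≤a)
                       (behind (a ∸ t) z≤n (subst (a ∸ t <_) (sym y≡e) (∸-monoʳ-< j<t t≤a)))))
                     free) λ ()
  misses-from-right o j a j<a blocked lands | inj₂ (_ , fwd) with scan-just o id (suc a) (n ∸ a) fwd
  ...   | y , a<y , _ , y≡j+1 , _ = <-asym j<a (subst (a <_) y≡j+1 a<y)

  lands-by-moving-forward : ∀ o j a → a ≤ j → suc j ≤ n → o (suc j) ≡ false →
    (∀ t → windowStart k a ≤ t → t ≤ j → o t ≡ true) → landing o a ≡ just (suc j)
  lands-by-moving-forward o j a a≤j j<n free occ = begin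
    landing o a                            ≡⟨ landing-split o a ⟩
    (backwardScan o a <∣> forwardScan o a) ≡⟨ cong (_<∣> forwardScan o a) passes ⟩
    forwardScan o a                        ≡⟨ stops ⟩
    just (suc j)                           ∎
    where
    C : ℕ
    C = backupDistance k a
    passes : backwardScan o a ≡ nothing
    passes = scan-passes o (a ∸_) 0 (suc C) λ z _ z<1+C →
      occ (a ∸ z) (∸-monoʳ-≤ a (≤-pred z<1+C)) (≤-trans (m∸n≤m a z) a≤j)
    j+1<end : suc j < suc a + (n ∸ a)
    j+1<end = s≤s (subst (suc j ≤_) (sym (m+[n∸m]≡n (≤-trans a≤j (<⇒≤ j<n)))) j<n)
    stops : forwardScan o a ≡ just (suc j)
    stops = scan-stops o id (suc a) (n ∸ a) (s≤s a≤j) j+1<end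
      (λ z a<z z<j+1 → occ z (≤-trans (m∸n≤m a C) (<⇒≤ a<z)) (≤-pred z<j+1)) free

  misses-from-left : ∀ o j a u → a ≤ j → windowStart k a ≤ u → u ≤ j → o u ≡ false →
    landing o a ≢ just (suc j)
  misses-from-left o j a u a≤j start≤u u≤j free lands rewrite landing-split o a with <∣>-just lands
  ... | inj₁ back with scan-just o (a ∸_) 0 (suc (backupDistance k a)) back
  ...   | y , _ , _ , a∸y≡j+1 , _ = 1+n≰n (subst (_≤ j) a∸y≡j+1 (≤-trans (m∸n≤m a y) a≤j))
  misses-from-left o j a u a≤j start≤u u≤j free lands | inj₂ (passes , fwd)
    with scan-just o id (suc a) (n ∸ a) fwd | u ≤? a
  ... | _ , _ , _ , _ , _ | yes u≤a =
    contradiction (trans (sym (subst (λ t → o t ≡ true) (m∸[m∸n]≡n u≤a) behind)) free) λ ()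
    where
    C : ℕ
    C = backupDistance k a
    a∸u≤C : a ∸ u ≤ C
    a∸u≤C = m≤n+o⇒m∸n≤o a u
      (≤-trans (m≤n+m∸n a C) (≤-trans (≤-reflexive (+-comm C (a ∸ C))) (+-monoˡ-≤ C start≤u)))
    behind : o (a ∸ (a ∸ u)) ≡ true
    behind = scan-nothing o (a ∸_) 0 (suc C) passes (a ∸ u) z≤n (s≤s a∸u≤C)
  ... | y , _ , _ , y≡j+1 , between | no u≰a =
    contradiction (trans (sym (between u (≰⇒> u≰a) (subst (u <_) (sym y≡j+1) (s≤s u≤j)))) free) λ ()

  module LandingCount
    (o : ℕ → Bool) (j R L : ℕ)
    (spot≤n         : suc j ≤ n)
    (spot-free      : o (suc j) ≡ false)
    (right-bound    : suc j + R ≤ n)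
    (right-occupied : ∀ t → suc j < t → t ≤ suc j + R → o t ≡ true)
    (right-end      : suc j + R < n → o (suc (suc j + R)) ≡ false)
    (left-bound     : L ≤ j)
    (left-occupied  : ∀ t → j ∸ L < t → t ≤ j → o t ≡ true)
    (left-end       : L < j → o (j ∸ L) ≡ false) where

    hits : ℕ → ℕ
    hits = iverson ∘ landsAt o (suc j)

    count-hits : ∀ x c → (∀ {a} → InRange x c a → landing o a ≡ just (suc j)) →
                 Sum.big (range x c) hits ≡ c
    count-hits x c lands = trans
      (Sum.big-congᴬ (All.map (λ a∈ → cong iverson (dec-true (Maybe.≡-dec _≟_ _ _) (lands a∈)))
                              (All-InRange-range x c)))
      (sum-ones x c)

    count-misses : ∀ x c → (∀ {a} → InRange x c a → landing o a ≢ just (suc j)) →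
                   Sum.big (range x c) hits ≡ 0
    count-misses x c misses = trans
      (Sum.big-congᴬ (All.map (λ a∈ → cong iverson (dec-false (Maybe.≡-dec _≟_ _ _) (misses a∈)))
                              (All-InRange-range x c)))
      (Sum.big-ε (range x c))

    B̃ : ℕ
    B̃ = R ⊓ k

    rest : ℕ
    rest = n ∸ suc j

    B̃≤rest : B̃ ≤ rest
    B̃≤rest = ≤-trans (m⊓n≤m R k) (m+n≤o⇒m≤o∸n R (subst (_≤ n) (+-comm (suc j) R) right-bound))

    right-hits : Sum.big (range (suc (suc j)) B̃) hits ≡ B̃
    right-hits = count-hits _ B̃ λ {a} (j+1<a , a<) →
      let a≤j+1+B̃ = ≤-pred a< in
      lands-by-backing-up o j a (<⇒≤ j+1<a) (≤-trans a≤j+1+B̃ (+-monoʳ-≤ (suc j) (m⊓n≤n R k))) spot-free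
        λ t j+1<t t≤a →
          right-occupied t j+1<t (≤-trans t≤a (≤-trans a≤j+1+B̃ (+-monoʳ-≤ (suc j) (m⊓n≤m R k))))

    right-misses : Sum.big (range (suc (suc j) + B̃) (rest ∸ B̃)) hits ≡ 0
    right-misses = count-misses _ (rest ∸ B̃) λ {a} (j+1+B̃<a , a<end) →
      misses-from-right o j a (≤-<-trans (m≤m+n (suc j) B̃) j+1+B̃<a) (blocked a j+1+B̃<a (a≤n a<end))
      where
      end≡ : suc (suc j) + B̃ + (rest ∸ B̃) ≡ suc n
      end≡ = cong suc (trans (+-assoc (suc j) B̃ (rest ∸ B̃))
               (trans (cong (suc j +_) (m+[n∸m]≡n B̃≤rest)) (m+[n∸m]≡n spot≤n)))
      a≤n : ∀ {a} → a < suc (suc j) + B̃ + (rest ∸ B̃) → a ≤ n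
      a≤n {a} a<end = ≤-pred (subst (a <_) end≡ a<end)
      blocked : ∀ a → suc (suc j + B̃) ≤ a → a ≤ n →
                suc j + k < a ⊎ ∃[ t ] suc j < t × t ≤ a × o t ≡ false
      blocked a j+1+B̃<a a≤n with R ≤? k
      ... | yes R≤k rewrite m≤n⇒m⊓n≡m R≤k =
            inj₂ (suc (suc j + R) , s≤s (m≤m+n (suc j) R) , j+1+B̃<a , right-end (<-≤-trans j+1+B̃<a a≤n))
      ... | no  R≰k rewrite m≥n⇒m⊓n≡n (<⇒≤ (≰⇒> R≰k)) = inj₁ j+1+B̃<a

    right-hits-all : Sum.big (range (suc (suc j)) rest) hits ≡ B̃
    right-hits-all = begin
      Sum.big (range (suc (suc j)) rest) hits
        ≡⟨ cong (λ c → Sum.big (range (suc (suc j)) c) hits) (m+[n∸m]≡n B̃≤rest) ⟨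
      Sum.big (range (suc (suc j)) (B̃ + (rest ∸ B̃))) hits
        ≡⟨ cong (λ xs → Sum.big xs hits) (range-++ (suc (suc j)) B̃ (rest ∸ B̃)) ⟩
      Sum.big (range (suc (suc j)) B̃ ++ range (suc (suc j) + B̃) (rest ∸ B̃)) hits
        ≡⟨ Sum.big-++ (range (suc (suc j)) B̃) _ hits ⟩
      Sum.big (range (suc (suc j)) B̃) hits + Sum.big (range (suc (suc j) + B̃) (rest ∸ B̃)) hits
        ≡⟨ cong₂ _+_ right-hits right-misses ⟩
      B̃ + 0
        ≡⟨ +-identityʳ B̃ ⟩
      B̃ ∎

    F̃ : ℕ
    F̃ = if L ≡ᵇ 0 then 0 else if L ≡ᵇ j then j ⊓ (n ∸ 1) else (L ∸ k) ⊓ (n ∸ 1)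

    j≤n∸1 : j ≤ n ∸ 1
    j≤n∸1 = m+n≤o⇒m≤o∸n j (subst (_≤ n) (+-comm 1 j) spot≤n)

    left-block-hits : L ≡ j → Sum.big (range 1 j) hits ≡ j
    left-block-hits L≡j = count-hits 1 j λ {a} (1≤a , a<1+j) →
      lands-by-moving-forward o j a (≤-pred a<1+j) spot≤n spot-free λ t start≤t t≤j →
        left-occupied t (subst (_< t) (sym (trans (cong (j ∸_) L≡j) (n∸n≡0 j)))
                                (≤-trans (1≤windowStart k 1≤a) start≤t)) t≤j

    left-gap-hits : L < j → Sum.big (range 1 j) hits ≡ L ∸ k
    left-gap-hits L<j = begin
      Sum.big (range 1 j) hits
        ≡⟨ cong (λ c → Sum.big (range 1 c) hits) (m∸n+n≡m F≤j) ⟨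
      Sum.big (range 1 (j ∸ F + F)) hits
        ≡⟨ cong (λ xs → Sum.big xs hits) (range-++ 1 (j ∸ F) F) ⟩
      Sum.big (range 1 (j ∸ F) ++ range (1 + (j ∸ F)) F) hits
        ≡⟨ Sum.big-++ (range 1 (j ∸ F)) _ hits ⟩
      Sum.big (range 1 (j ∸ F)) hits + Sum.big (range (1 + (j ∸ F)) F) hits
        ≡⟨ cong₂ _+_ misses hits′ ⟩
      0 + F ∎
      where
      F : ℕ
      F = L ∸ k
      F≤j : F ≤ j
      F≤j = ≤-trans (m∸n≤m L k) left-bound
      misses : Sum.big (range 1 (j ∸ F)) hits ≡ 0
      misses = count-misses 1 (j ∸ F) λ {a} (1≤a , a<1+j∸F) →
        let a≤j∸F = ≤-pred a<1+j∸F in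
        misses-from-left o j a (j ∸ L) (≤-trans a≤j∸F (m∸n≤m j F))
          (window-reaches-gap k j L L<j a 1≤a a≤j∸F) (m∸n≤m j L) (left-end L<j)
      hits′ : Sum.big (range (1 + (j ∸ F)) F) hits ≡ F
      hits′ = count-hits (1 + (j ∸ F)) F λ {a} (j∸F<a , a<) →
        let a≤j = ≤-pred (subst (a <_) (cong suc (m∸n+n≡m F≤j)) a<) in
        lands-by-moving-forward o j a a≤j spot≤n spot-free λ t start≤t t≤j →
          left-occupied t (<-≤-trans (window-inside-block k j L L<j a a≤j j∸F<a) start≤t) t≤j

    left-hits : Sum.big (range 1 j) hits ≡ F̃
    left-hits with L ≟ j
    ... | yes L≡j = trans (left-block-hits L≡j) (sym F̃≡j)
      where
      F̃≡j : F̃ ≡ j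
      F̃≡j with L ≟ 0
      ... | yes L≡0 = trans (if-yes (L ≟ 0) L≡0) (trans (sym L≡0) L≡j)
      ... | no  L≢0 = trans (if-no (L ≟ 0) L≢0) (trans (if-yes (L ≟ j) L≡j) (m≤n⇒m⊓n≡m j≤n∸1))
    ... | no  L≢j = trans (left-gap-hits L<j) (sym F̃≡L∸k)
      where
      L<j : L < j
      L<j = ≤∧≢⇒< left-bound L≢j
      F̃≡L∸k : F̃ ≡ L ∸ k
      F̃≡L∸k with L ≟ 0
      ... | yes L≡0 = trans (if-yes (L ≟ 0) L≡0) (sym (trans (cong (_∸ k) L≡0) (0∸n≡0 k)))
      ... | no  L≢0 = trans (if-no (L ≟ 0) L≢0) (trans (if-no (L ≟ j) L≢j)
                        (m≤n⇒m⊓n≡m (≤-trans (m∸n≤m L k) (≤-trans left-bound j≤n∸1))))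

    landingCount-spot : landingCount o (suc j) ≡ B̃ + F̃ + 1
    landingCount-spot = begin
      Sum.big (range 1 n) hits
        ≡⟨ cong (λ c → Sum.big (range 1 c) hits) (trans (+-suc j rest) (m+[n∸m]≡n spot≤n)) ⟨
      Sum.big (range 1 (j + suc rest)) hits
        ≡⟨ cong (λ xs → Sum.big xs hits) (range-++ 1 j (suc rest)) ⟩
      Sum.big (range 1 j ++ suc j ∷ range (suc (suc j)) rest) hits
        ≡⟨ Sum.big-++ (range 1 j) _ hits ⟩
      Sum.big (range 1 j) hits + (hits (suc j) + Sum.big (range (suc (suc j)) rest) hits)
        ≡⟨ cong₂ (λ l r → l + (hits (suc j) + r)) left-hits right-hits-all ⟩
      F̃ + (hits (suc j) + B̃)
        ≡⟨ cong (λ h → F̃ + (h + B̃)) self ⟩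
      F̃ + (1 + B̃)
        ≡⟨ solve 2 (λ f b → f :+ (con 1 :+ b) := b :+ f :+ con 1) refl F̃ B̃ ⟩
      B̃ + F̃ + 1 ∎
      where
      self : hits (suc j) ≡ 1
      self = cong iverson (dec-true (Maybe.≡-dec _≟_ _ _)
               (lands-by-backing-up o j (suc j) ≤-refl (m≤m+n (suc j) k) spot-free
                 λ t j+1<t t≤j+1 → contradiction t≤j+1 (<⇒≱ j+1<t)))

  outcomeWeight : List ℕ → List ℕ → ℕ
  outcomeWeight occ []       = 1
  outcomeWeight occ (s ∷ ss) = landingCount (occupied occ) s * outcomeWeight (s ∷ occ) ss

  outcomeWeight≢0⇒fresh : ∀ occ p → outcomeWeight occ p ≢ 0 →
                          All (λ s → occupied occ s ≡ false) p × DistinctEntries p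
  outcomeWeight≢0⇒fresh occ []       _   = [] , λ { {suc _} (_ , s≤s ()) }
  outcomeWeight≢0⇒fresh occ (x ∷ xs) w≢0 = x-free ∷ All.map (proj₂ ∘ split) fresh , inj′
    where
    rest≢0 : outcomeWeight (x ∷ occ) xs ≢ 0
    rest≢0 z = w≢0 (trans (cong (landingCount (occupied occ) x *_) z)
                          (*-zeroʳ (landingCount (occupied occ) x)))
    fresh : All (λ s → occupied (x ∷ occ) s ≡ false) xs
    fresh = proj₁ (outcomeWeight≢0⇒fresh (x ∷ occ) xs rest≢0)
    inj : DistinctEntries xs
    inj = proj₂ (outcomeWeight≢0⇒fresh (x ∷ occ) xs rest≢0)
    split : ∀ {s} → occupied (x ∷ occ) s ≡ false → x ≢ s × occupied occ s ≡ false
    split {s} free with x ≡ᵇ s | ≡ᵇ-reflects x s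
    ... | false | ofⁿ x≢s = x≢s , free
    x-free : occupied occ x ≡ false
    x-free with occupied occ x in taken
    ... | true  = contradiction
      (cong (_* outcomeWeight (x ∷ occ) xs) (landingCount-occupied (occupied occ) taken)) w≢0
    ... | false = refl
    inj′ : DistinctEntries (x ∷ xs)
    inj′ {suc zero}    {suc zero}    _               _                _ = refl
    inj′ {suc zero}    {suc (suc i)} _               (_ , s≤s i<len)  e =
      contradiction e (proj₁ (split (All-entry fresh (s≤s z≤n , i<len))))
    inj′ {suc (suc i)} {suc zero}    (_ , s≤s i<len) _                e =
      contradiction (sym e) (proj₁ (split (All-entry fresh (s≤s z≤n , i<len))))
    inj′ {suc (suc i)} {suc (suc i′)} (_ , s≤s i<len) (_ , s≤s i′<len) e =
      cong suc (inj (s≤s z≤n , i<len) (s≤s z≤n , i′<len) e)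

  parkingCount : List ℕ → ℕ → ℕ
  parkingCount occ r = Sum.big (words r (range 1 n)) (λ α → iverson (parkAll k n occ α))

  parkingCount-suc : ∀ occ r a →
    Sum.big (words r (range 1 n)) (λ α → iverson (parkAll k n occ (a ∷ α)))
      ≡ maybe′ (λ s → parkingCount (s ∷ occ) r) 0 (landing (occupied occ) a)
  parkingCount-suc occ r a
    rewrite sym (firstFree≡firstUnoccupied occ (naplesCandidates k n a))
    with firstFree occ (naplesCandidates k n a)
  ... | nothing = Sum.big-ε (words r (range 1 n))
  ... | just s  = refl

  parkingCount≡sum-outcomeWeight : ∀ r occ →
    parkingCount occ r ≡ Sum.big (words r (range 1 n)) (outcomeWeight occ)
  parkingCount≡sum-outcomeWeight zero    occ = refl
  parkingCount≡sum-outcomeWeight (suc r) occ = begin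
    Sum.big (words (suc r) A) (λ α → iverson (parkAll k n occ α))
      ≡⟨ Sum.big-words-suc r A _ ⟩
    Sum.big A (λ a → Sum.big W (λ α → iverson (parkAll k n occ (a ∷ α))))
      ≡⟨ Sum.big-cong A (parkingCount-suc occ r) ⟩
    Sum.big A (λ a → maybe′ (λ s → parkingCount (s ∷ occ) r) 0 (landing o a))
      ≡⟨ Sum.big-cong A (λ a → maybe′-cong (λ s → parkingCount≡sum-outcomeWeight r (s ∷ occ))
                                           (landing o a)) ⟩
    Sum.big A (λ a → maybe′ X 0 (landing o a))
      ≡⟨ Sum.big-congᴬ (All.map (λ a∈ → Sum.big-select-maybe 1 n (landing-InRange o a∈) X)
                                (All-InRange-range 1 n)) ⟩
    Sum.big A (λ a → Sum.big A (λ s → if landsAt o s a then X s else 0))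
      ≡⟨ Sum.big-comm A A _ ⟩
    Sum.big A (λ s → Sum.big A (λ a → if landsAt o s a then X s else 0))
      ≡⟨ Sum.big-cong A count ⟩
    Sum.big A (λ s → landingCount o s * X s)
      ≡⟨ Sum.big-cong A (λ s → sum-*ˡ (landingCount o s) W _) ⟩
    Sum.big A (λ s → Sum.big W (λ w → outcomeWeight occ (s ∷ w)))
      ≡⟨ Sum.big-words-suc r A (outcomeWeight occ) ⟨
    Sum.big (words (suc r) A) (outcomeWeight occ) ∎
    where
    o : ℕ → Bool
    o = occupied occ
    A : List ℕ
    A = range 1 n
    W : List (List ℕ)
    W = words r A
    X : ℕ → ℕ
    X s = Sum.big W (outcomeWeight (s ∷ occ))
    count : ∀ s → Sum.big A (λ a → if landsAt o s a then X s else 0) ≡ landingCount o s * X s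
    count s = trans (Sum.big-cong A (λ a → iverson-* (landsAt o s a) (X s))) (sym (sum-*ʳ (X s) A _))

  numNaplesPF≡sum-outcomeWeight : ∀ m → numNaplesPF m n k ≡ Sum.big (words m (range 1 n)) (outcomeWeight [])
  numNaplesPF≡sum-outcomeWeight m = begin
    numNaplesPF m n k
      ≡⟨ length-filterᵇ (isNaplesPF k n) (words m (fromTo 1 n)) ⟩
    Sum.big (words m (fromTo 1 n)) (iverson ∘ parkAll k n [])
      ≡⟨ cong (λ xs → Sum.big (words m xs) (iverson ∘ parkAll k n [])) (fromTo≡range 1 n) ⟩
    parkingCount [] m
      ≡⟨ parkingCount≡sum-outcomeWeight m [] ⟩
    Sum.big (words m (range 1 n)) (outcomeWeight []) ∎

-- Outcomes and the words of 𝔖_{m,n}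

equal-if-same-nonzero : ∀ {a b} → (∀ {v} → 1 ≤ v → a ≡ v → b ≡ v) →
                        (∀ {v} → 1 ≤ v → b ≡ v → a ≡ v) → a ≡ b
equal-if-same-nonzero {zero}  {zero}  _    _    = refl
equal-if-same-nonzero {suc a} {_}     a⇒b  _    = sym (a⇒b (s≤s z≤n) refl)
equal-if-same-nonzero {zero}  {suc b} _    b⇒a  = b⇒a (s≤s z≤n) refl

module Correspondence (m n : ℕ) where

  Outcome Street : List ℕ → Set
  Outcome = Word m 1 n
  Street  = Word n 0 (suc m)

  Inverse : List ℕ → List ℕ → Set
  Inverse π p = ∀ {i v} → InRange 1 n i → InRange 1 m v →
                (entry π i ≡ v → entry p v ≡ i) × (entry p v ≡ i → entry π i ≡ v)

  streetOf : List ℕ → List ℕ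
  streetOf p = map (λ i → positionOf i p) (range 1 n)

  outcomeOf : List ℕ → List ℕ
  outcomeOf π = map (λ v → positionOf v π) (range 1 m)

  length-streetOf : ∀ p → length (streetOf p) ≡ n
  length-streetOf p = trans (List.length-map _ (range 1 n)) (length-range 1 n)

  length-outcomeOf : ∀ π → length (outcomeOf π) ≡ m
  length-outcomeOf π = trans (List.length-map _ (range 1 m)) (length-range 1 m)

  streetOf-inverse : ∀ {p} → Outcome p → DistinctEntries p → Street (streetOf p) × Inverse (streetOf p) p
  streetOf-inverse {p} (len , _) distinct = (length-streetOf p , cars-in-range) , inverse
    where
    cars-in-range : All (InRange 0 (suc m)) (streetOf p)
    cars-in-range = AllP.map⁺ (All.map (λ _ → z≤n , s≤s (≤-trans (positionOf≤length _ p) (≤-reflexive len)))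
                                       (All-InRange-range 1 n))
    inverse : Inverse (streetOf p) p
    inverse {i} {v} i∈ v∈ = to , from
      where
      to : entry (streetOf p) i ≡ v → entry p v ≡ i
      to πi≡v = subst (λ u → entry p u ≡ i) pos≡v
                      (entry-positionOf i p (subst (1 ≤_) (sym pos≡v) (proj₁ v∈)))
        where
        pos≡v : positionOf i p ≡ v
        pos≡v = trans (sym (entry-map-range₁ _ n i∈)) πi≡v
      from : entry p v ≡ i → entry (streetOf p) i ≡ v
      from pv≡i = trans (entry-map-range₁ _ n i∈)
                        (OccursOnlyAt-positionOf p (InRange⇒Index p len v∈ , pv≡i , only))
        where
        only : ∀ {v′} → Index p v′ → entry p v′ ≡ i → v′ ≡ v
        only v′∈ pv′≡i = distinct v′∈ (InRange⇒Index p len v∈) (trans pv′≡i (sym pv≡i))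

  outcomeOf-inverse : ∀ {π} → Street π → isInS m π ≡ true →
                      Outcome (outcomeOf π) × Inverse π (outcomeOf π)
  outcomeOf-inverse {π} (len , _) inS = (length-outcomeOf π , spots-in-range) , inverse
    where
    only-at : ∀ {v} → InRange 1 m v → OccursOnlyAt v π (positionOf v π)
    only-at v∈ = occurrences≡1⇒OccursOnlyAt _ π (isInS⇒OccursOnce m π inS v∈)
    spots-in-range : All (InRange 1 n) (outcomeOf π)
    spots-in-range = entry-All _ λ {v} v∈ →
      let v∈′ = Index⇒InRange (outcomeOf π) (length-outcomeOf π) v∈ in
      subst (InRange 1 n) (sym (entry-map-range₁ _ m v∈′)) (Index⇒InRange π len (proj₁ (only-at v∈′)))
    inverse : Inverse π (outcomeOf π)
    inverse {i} {v} i∈ v∈ = to , from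
      where
      to : entry π i ≡ v → entry (outcomeOf π) v ≡ i
      to πi≡v = trans (entry-map-range₁ _ m v∈)
                      (sym (proj₂ (proj₂ (only-at v∈)) (InRange⇒Index π len i∈) πi≡v))
      from : entry (outcomeOf π) v ≡ i → entry π i ≡ v
      from pv≡i = subst (λ u → entry π u ≡ v) (trans (sym (entry-map-range₁ _ m v∈)) pv≡i)
                        (proj₁ (proj₂ (only-at v∈)))

  module _ {π p} (street : Street π) (outcome : Outcome p) (inverse : Inverse π p) where

    private
      spot-InRange : ∀ {v} → InRange 1 m v → InRange 1 n (entry p v)
      spot-InRange v∈ = All-entry (proj₂ outcome) (InRange⇒Index p (proj₁ outcome) v∈)

      car-InRange : ∀ {σ i v} → Street σ → InRange 1 n i → 1 ≤ v → entry σ i ≡ v → InRange 1 m v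
      car-InRange {σ} (len , all) i∈ 1≤v refl = 1≤v , proj₂ (All-entry all (InRange⇒Index σ len i∈))

    inverse⇒isInS : isInS m π ≡ true
    inverse⇒isInS = OccursOnce⇒isInS m π λ {v} v∈ →
      OccursOnlyAt⇒occurrences≡1 v π
        ( InRange⇒Index π (proj₁ street) (spot-InRange v∈)
        , proj₂ (inverse (spot-InRange v∈) v∈) refl
        , λ i∈ πi≡v → sym (proj₁ (inverse (Index⇒InRange π (proj₁ street) i∈) v∈) πi≡v))

    inverse⇒distinct : DistinctEntries p
    inverse⇒distinct {v} {v′} v∈ v′∈ pv≡pv′ =
      trans (sym (proj₂ (inverse (spot-InRange v∈′) v∈′) refl))
            (proj₂ (inverse (spot-InRange v∈′) (Index⇒InRange p (proj₁ outcome) v′∈)) (sym pv≡pv′))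
      where
      v∈′ : InRange 1 m v
      v∈′ = Index⇒InRange p (proj₁ outcome) v∈

    inverse-unique-outcome : ∀ {p′} → Outcome p′ → Inverse π p′ → p ≡ p′
    inverse-unique-outcome {p′} outcome′ inverse′ =
      entry-ext p p′ (trans (proj₁ outcome) (sym (proj₁ outcome′))) λ v∈ →
        let v∈′ = Index⇒InRange p (proj₁ outcome) v∈ in
        sym (proj₁ (inverse′ (spot-InRange v∈′) v∈′) (proj₂ (inverse (spot-InRange v∈′) v∈′) refl))

    inverse-unique-street : ∀ {π′} → Street π′ → Inverse π′ p → π ≡ π′
    inverse-unique-street {π′} street′ inverse′ =
      entry-ext π π′ (trans (proj₁ street) (sym (proj₁ street′))) λ i∈ →
        let i∈′ = Index⇒InRange π (proj₁ street) i∈ in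
        equal-if-same-nonzero (transfer street inverse π′ inverse′ i∈′)
                              (transfer street′ inverse′ π inverse i∈′)
      where
      transfer : ∀ {σ} → Street σ → Inverse σ p → ∀ σ′ → Inverse σ′ p →
                 ∀ {i v} → InRange 1 n i → 1 ≤ v → entry σ i ≡ v → entry σ′ i ≡ v
      transfer st inv _ inv′ i∈ 1≤v σi≡v =
        let v∈ = car-InRange st i∈ 1≤v σi≡v in proj₂ (inv′ i∈ v∈) (proj₁ (inv i∈ v∈) σi≡v)

-- The weight of a word

arrivedBefore : ℕ → ℕ → Bool
arrivedBefore v x = does ((0 <? x) ×-dec (x <? v))

run≤length : ∀ v ts → run v ts ≤ length ts
run≤length v []       = z≤n
run≤length v (t ∷ ts) with arrivedBefore v t
... | true  = s≤s (run≤length v ts)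
... | false = z≤n

run-arrivedBefore : ∀ v ts {d} → d < run v ts → arrivedBefore v (entry ts (suc d)) ≡ true
run-arrivedBefore v (t ∷ ts) {d} d<run with arrivedBefore v t in before
run-arrivedBefore v (t ∷ ts) {zero}  _           | true = before
run-arrivedBefore v (t ∷ ts) {suc d} (s≤s d<run) | true = run-arrivedBefore v ts d<run

run-stops : ∀ v ts → run v ts < length ts → arrivedBefore v (entry ts (suc (run v ts))) ≡ false
run-stops v (t ∷ ts) run<len with arrivedBefore v t in before
... | true  = run-stops v ts (≤-pred run<len)
... | false = before

module Weights (k n : ℕ) where

  open Naples k n

  occupiedBefore : List ℕ → ℕ → ℕ → Bool
  occupiedBefore π v s = arrivedBefore v (entry π s)

  carWeight : List ℕ → ℕ → ℕ → ℕ
  carWeight π t zero    = 1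
  carWeight π t (suc v) = landingCount (occupiedBefore π (suc v)) t

  module AroundSpot (pre : List ℕ) (v : ℕ) (suf : List ℕ) (len : length (pre ʳ++ v ∷ suf) ≡ n) where

    π : List ℕ
    π = pre ʳ++ v ∷ suf

    o : ℕ → Bool
    o = occupiedBefore π v

    j R L : ℕ
    j = length pre
    R = run v suf
    L = run v pre

    n≡ : j + suc (length suf) ≡ n
    n≡ = trans (sym (List.length-ʳ++ pre)) len

    entry-spot : entry π (suc j) ≡ v
    entry-spot = trans (cong (entry π) (+-comm 1 j)) (entry-ʳ++-right pre (v ∷ suf) 0)

    entry-after : ∀ d → entry π (suc (suc j) + d) ≡ entry suf (suc d)
    entry-after d = trans (cong (entry π) (sym (trans (+-suc j (suc d)) (cong suc (+-suc j d)))))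
                          (entry-ʳ++-right pre (v ∷ suf) (suc d))

    spot≤n : suc j ≤ n
    spot≤n = subst (suc j ≤_) n≡ (subst (_≤ j + suc (length suf)) (+-comm j 1) (+-monoʳ-≤ j (s≤s z≤n)))

    spot-free : o (suc j) ≡ false
    spot-free rewrite entry-spot = dec-false ((0 <? v) ×-dec (v <? v)) (λ (_ , v<v) → <-irrefl refl v<v)

    right-bound : suc j + R ≤ n
    right-bound = subst (suc j + R ≤_) (trans (sym (+-suc j (length suf))) n≡)
                        (+-monoʳ-≤ (suc j) (run≤length v suf))

    right-occupied : ∀ t → suc j < t → t ≤ suc j + R → o t ≡ true
    right-occupied t j+1<t t≤j+1+R = subst (λ t → o t ≡ true) (m+[n∸m]≡n j+1<t)
      (trans (cong (arrivedBefore v) (entry-after d)) (run-arrivedBefore v suf d<R))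
      where
      d : ℕ
      d = t ∸ suc (suc j)
      d<R : d < R
      d<R = subst (d <_) (m+n∸m≡n (suc (suc j)) R) (∸-monoˡ-< (s≤s t≤j+1+R) j+1<t)

    right-end : suc j + R < n → o (suc (suc j + R)) ≡ false
    right-end j+1+R<n = trans (cong (arrivedBefore v) (entry-after R)) (run-stops v suf R<len)
      where
      R<len : R < length suf
      R<len = +-cancelˡ-< (suc j) R (length suf)
                (subst (suc j + R <_) (sym (trans (sym (+-suc j (length suf))) n≡)) j+1+R<n)

    left-occupied : ∀ t → j ∸ L < t → t ≤ j → o t ≡ true
    left-occupied t j∸L<t t≤j = subst (λ t → o t ≡ true) (m∸[m∸n]≡n t≤j)
      (trans (cong (arrivedBefore v) (entry-ʳ++-left pre (v ∷ suf) d<j)) (run-arrivedBefore v pre d<L))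
      where
      d : ℕ
      d = j ∸ t
      d<L : d < L
      d<L = subst (d <_) (m∸[m∸n]≡n (run≤length v pre)) (∸-monoʳ-< j∸L<t t≤j)
      d<j : d < j
      d<j = <-≤-trans d<L (run≤length v pre)

    left-end : L < j → o (j ∸ L) ≡ false
    left-end L<j = trans (cong (arrivedBefore v) (entry-ʳ++-left pre (v ∷ suf) L<j)) (run-stops v pre L<j)

  factor≡carWeight : ∀ pre v suf → length (pre ʳ++ v ∷ suf) ≡ n →
    factor k n (suc (length pre)) pre v suf
      ≡ carWeight (pre ʳ++ v ∷ suf) (suc (length pre)) (entry (pre ʳ++ v ∷ suf) (suc (length pre)))
  factor≡carWeight pre zero     suf len = sym (cong (carWeight π (suc j)) entry-spot)
    where open AroundSpot pre zero suf len
  factor≡carWeight pre (suc v′) suf len =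
    trans (sym (LandingCount.landingCount-spot o j R L spot≤n spot-free right-bound right-occupied right-end
                                               (run≤length (suc v′) pre) left-occupied left-end))
          (sym (cong (carWeight π (suc j)) entry-spot))
    where open AroundSpot pre (suc v′) suf len

  prodFactors≡product : ∀ pre xs → length (pre ʳ++ xs) ≡ n →
    prodFactors k n pre (suc (length pre)) xs
      ≡ Product.big (range (suc (length pre)) (length xs)) (λ t → carWeight (pre ʳ++ xs) t (entry (pre ʳ++ xs) t))
  prodFactors≡product pre []       len = refl
  prodFactors≡product pre (v ∷ vs) len =
    cong₂ _*_ (factor≡carWeight pre v vs len) (prodFactors≡product (v ∷ pre) vs len)

  weight≡product : ∀ π → length π ≡ n →
                   weight k n π ≡ Product.big (range 1 n) (λ t → carWeight π t (entry π t))
  weight≡product π len = trans (prodFactors≡product [] π len)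
    (cong (λ c → Product.big (range 1 c) (λ t → carWeight π t (entry π t))) len)

  module _ (m : ℕ) {π p : List ℕ} where

    open Correspondence m n

    module _ (street : Street π) (outcome : Outcome p) (inverse : Inverse π p) where

      occupied-prefix : ∀ occ x ys → occ ʳ++ x ∷ ys ≡ p → ∀ {s} → InRange 1 n s →
                        occupied occ s ≡ occupiedBefore π (suc (length occ)) s
      occupied-prefix occ x ys split {s} s∈ = Bool-ext occupied⇒before before⇒occupied
        where
        len : ℕ
        len = length occ
        len<m : len < m
        len<m = subst (len <_) (trans (sym (List.length-ʳ++ occ)) (trans (cong length split) (proj₁ outcome)))
                      (m<m+n len z<s)
        entry-p : ∀ {d} → d < len → entry p (len ∸ d) ≡ entry occ (suc d)
        entry-p {d} d<len =
          trans (cong (λ q → entry q (len ∸ d)) (sym split)) (entry-ʳ++-left occ (x ∷ ys) d<len)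
        occupied⇒before : occupied occ s ≡ true → occupiedBefore π (suc len) s ≡ true
        occupied⇒before occ-s with occupied⇒entry occ occ-s
        ... | suc d , (_ , s≤s d<len) , entry≡s =
          subst (λ u → arrivedBefore (suc len) u ≡ true) (sym πs≡u)
                (dec-true ((0 <? u) ×-dec (u <? suc len)) (0<u , s≤s (m∸n≤m len d)))
          where
          u : ℕ
          u = len ∸ d
          0<u : 0 < u
          0<u = m<n⇒0<n∸m d<len
          πs≡u : entry π s ≡ u
          πs≡u = proj₂ (inverse s∈ (0<u , s≤s (≤-trans (m∸n≤m len d) (<⇒≤ len<m))))
                       (trans (entry-p d<len) entry≡s)
        before⇒occupied : occupiedBefore π (suc len) s ≡ true → occupied occ s ≡ true
        before⇒occupied before with does-true ((0 <? entry π s) ×-dec (entry π s <? suc len)) before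
        ... | 0<u , s≤s u≤len =
          entry⇒occupied occ (s≤s z≤n , s≤s d<len) (trans (sym (entry-p d<len)) pu≡s)
          where
          u d : ℕ
          u = entry π s
          d = len ∸ u
          d<len : d < len
          d<len = ∸-monoʳ-< 0<u u≤len
          pu≡s : entry p (len ∸ d) ≡ s
          pu≡s = trans (cong (entry p) (m∸[m∸n]≡n u≤len))
                       (proj₁ (inverse s∈ (0<u , s≤s (≤-trans u≤len (<⇒≤ len<m)))) refl)

      outcomeWeight≡product : ∀ occ ys → occ ʳ++ ys ≡ p →
        outcomeWeight occ ys ≡ Product.big (range (suc (length occ)) (length ys)) (λ v → carWeight π (entry p v) v)
      outcomeWeight≡product occ []       split = refl
      outcomeWeight≡product occ (x ∷ ys) split = cong₂ _*_
        (trans (landingCount-cong (occupied-prefix occ x ys split) x) (cong (λ s → carWeight π s v) (sym pv≡x)))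
        (outcomeWeight≡product (x ∷ occ) ys split)
        where
        v : ℕ
        v = suc (length occ)
        pv≡x : entry p v ≡ x
        pv≡x = trans (cong (λ q → entry q v) (sym split))
                     (trans (cong (entry (occ ʳ++ x ∷ ys)) (+-comm 1 (length occ)))
                            (entry-ʳ++-right occ (x ∷ ys) 0))

      product-by-spot≡product-by-car :
        Product.big (range 1 n) (λ t → carWeight π t (entry π t))
          ≡ Product.big (range 1 m) (λ v → carWeight π (entry p v) v)
      product-by-spot≡product-by-car = begin
        Product.big (range 1 n) (λ t → Φ t (entry π t))
          ≡⟨ Product.big-congᴬ (All.map (λ t∈ → Product.big-select-or-ε m (Φ _) refl (car-bound t∈))
                                         (All-InRange-range 1 n)) ⟩
        Product.big (range 1 n) (λ t → Product.big (range 1 m) (λ v → if entry π t ≡ᵇ v then Φ t v else 1))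
          ≡⟨ Product.big-comm (range 1 n) (range 1 m) _ ⟩
        Product.big (range 1 m) (λ v → Product.big (range 1 n) (λ t → if entry π t ≡ᵇ v then Φ t v else 1))
          ≡⟨ Product.big-congᴬ (All.map (λ v∈ → Product.big-congᴬ (All.map (λ t∈ → swap-test t∈ v∈)
                                                                           (All-InRange-range 1 n)))
                                         (All-InRange-range 1 m)) ⟩
        Product.big (range 1 m) (λ v → Product.big (range 1 n) (λ t → if entry p v ≡ᵇ t then Φ t v else 1))
          ≡⟨ Product.big-congᴬ (All.map (λ {v} v∈ → Product.big-select 1 n (spot-bound v∈) (λ t → Φ t v))
                                         (All-InRange-range 1 m)) ⟩
        Product.big (range 1 m) (λ v → Φ (entry p v) v) ∎
        where
        Φ : ℕ → ℕ → ℕ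
        Φ = carWeight π
        car-bound : ∀ {t} → InRange 1 n t → entry π t < 1 + m
        car-bound {t} t∈ = proj₂ (All-entry (proj₂ street) (InRange⇒Index π (proj₁ street) t∈))
        spot-bound : ∀ {v} → InRange 1 m v → InRange 1 n (entry p v)
        spot-bound {v} v∈ = All-entry (proj₂ outcome) (InRange⇒Index p (proj₁ outcome) v∈)
        same-pair : ∀ {t v} → InRange 1 n t → InRange 1 m v → (entry π t ≡ᵇ v) ≡ (entry p v ≡ᵇ t)
        same-pair {t} {v} t∈ v∈ = Bool-ext
          (λ e → dec-true (entry p v ≟ t) (proj₁ (inverse t∈ v∈) (does-true (entry π t ≟ v) e)))
          (λ e → dec-true (entry π t ≟ v) (proj₂ (inverse t∈ v∈) (does-true (entry p v ≟ t) e)))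
        swap-test : ∀ {t v} → InRange 1 n t → InRange 1 m v →
                    (if entry π t ≡ᵇ v then Φ t v else 1) ≡ (if entry p v ≡ᵇ t then Φ t v else 1)
        swap-test {t} {v} t∈ v∈ = cong (λ b → if b then Φ t v else 1) (same-pair t∈ v∈)

      weight≡outcomeWeight : weight k n π ≡ outcomeWeight [] p
      weight≡outcomeWeight = begin
        weight k n π
          ≡⟨ weight≡product π (proj₁ street) ⟩
        Product.big (range 1 n) (λ t → carWeight π t (entry π t))
          ≡⟨ product-by-spot≡product-by-car ⟩
        Product.big (range 1 m) (λ v → carWeight π (entry p v) v)
          ≡⟨ cong (λ c → Product.big (range 1 c) (λ v → carWeight π (entry p v) v)) (proj₁ outcome) ⟨
        Product.big (range 1 (length p)) (λ v → carWeight π (entry p v) v)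
          ≡⟨ outcomeWeight≡product [] p refl ⟨
        outcomeWeight [] p ∎

module Matching (m n k : ℕ) where

  open Naples k n
  open Correspondence m n
  open Weights k n

  streetWeight : List ℕ → ℕ
  streetWeight π = if isInS m π then weight k n π else 0

  outcome-matched : ∀ p → Outcome p → outcomeWeight [] p ≡ 0 ⊎
    (Street (streetOf p) × outcomeOf (streetOf p) ≡ p × streetWeight (streetOf p) ≡ outcomeWeight [] p)
  outcome-matched p outcome with outcomeWeight [] p ≟ 0
  ... | yes w≡0 = inj₁ w≡0
  ... | no  w≢0 = inj₂ (street , inverse-unique-outcome street outcome′ inverse′ outcome inverse , weight≡)
    where
    street-inverse : Street (streetOf p) × Inverse (streetOf p) p
    street-inverse = streetOf-inverse outcome (proj₂ (outcomeWeight≢0⇒fresh [] p w≢0))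
    street : Street (streetOf p)
    street = proj₁ street-inverse
    inverse : Inverse (streetOf p) p
    inverse = proj₂ street-inverse
    inS : isInS m (streetOf p) ≡ true
    inS = inverse⇒isInS street outcome inverse
    outcome′ : Outcome (outcomeOf (streetOf p))
    outcome′ = proj₁ (outcomeOf-inverse street inS)
    inverse′ : Inverse (streetOf p) (outcomeOf (streetOf p))
    inverse′ = proj₂ (outcomeOf-inverse street inS)
    weight≡ : streetWeight (streetOf p) ≡ outcomeWeight [] p
    weight≡ rewrite inS = weight≡outcomeWeight m street outcome inverse

  street-matched : ∀ π → Street π → streetWeight π ≡ 0 ⊎
    (Outcome (outcomeOf π) × streetOf (outcomeOf π) ≡ π × outcomeWeight [] (outcomeOf π) ≡ streetWeight π)
  street-matched π street with isInS m π in inS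
  ... | false = inj₁ refl
  ... | true  = inj₂ ( outcome
                     , sym (inverse-unique-street street outcome inverse street′ inverse′)
                     , sym (weight≡outcomeWeight m street outcome inverse))
    where
    outcome : Outcome (outcomeOf π)
    outcome = proj₁ (outcomeOf-inverse street inS)
    inverse : Inverse π (outcomeOf π)
    inverse = proj₂ (outcomeOf-inverse street inS)
    street-inverse : Street (streetOf (outcomeOf π)) × Inverse (streetOf (outcomeOf π)) (outcomeOf π)
    street-inverse = streetOf-inverse outcome (inverse⇒distinct street outcome inverse)
    street′ : Street (streetOf (outcomeOf π))
    street′ = proj₁ street-inverse
    inverse′ : Inverse (streetOf (outcomeOf π)) (outcomeOf π)
    inverse′ = proj₂ street-inverse

  sum-outcomeWeight≡sum-streetWeight :
    Sum.big (words m (range 1 n)) (outcomeWeight []) ≡ Sum.big (words n (range 0 (suc m))) streetWeight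
  sum-outcomeWeight≡sum-streetWeight =
    Sum.big-reindex (List.≡-dec _≟_) (List.≡-dec _≟_)
      (All-words m (All-InRange-range 1 n)) (All-words n (All-InRange-range 0 (suc m)))
      (Sum.big-select-word m 1 n) (Sum.big-select-word n 0 (suc m))
      (outcomeWeight []) streetWeight streetOf outcomeOf outcome-matched street-matched

  rhs≡sum-streetWeight : rhs m n k ≡ Sum.big (words n (range 0 (suc m))) streetWeight
  rhs≡sum-streetWeight = trans (sum-map-filterᵇ (isInS m) (weight k n) (words n (fromTo 0 m)))
                               (cong (λ xs → Sum.big (words n xs) streetWeight) (fromTo≡range 0 m))

corollary2p16 : (m n k : ℕ) → 1 ≤ m → m ≤ n → k < n →
    numNaplesPF m n k ≡ rhs m n k
corollary2p16 m n k _ _ _ = begin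
  numNaplesPF m n k                                ≡⟨ numNaplesPF≡sum-outcomeWeight m ⟩
  Sum.big (words m (range 1 n)) (outcomeWeight []) ≡⟨ sum-outcomeWeight≡sum-streetWeight ⟩
  Sum.big (words n (range 0 (suc m))) streetWeight ≡⟨ rhs≡sum-streetWeight ⟨
  rhs m n k                                        ∎
  where
  open Naples k n
  open Matching m n k
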